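{- Given $n$ unsorted positive weights $W[1..n]$, there is a deferred (online, lazily sorting) data structure which supports any sequence of $q$ operations of type $\mathtt{rank}$, $\mathtt{select}$ and $\mathtt{partialSum}$ on $W$ in total time within $O(n(1+\lg q)+q(1+\log n))$, all within the algebraic decision tree computational model.
   Context: For the multiset $W$: $\mathtt{rank}(x)$ is the number of elements of $W$ strictly smaller than $x$; $\mathtt{select}(r)$ is the $r$-th smallest value of $W$ (counted with multiplicity), for $r\in[1..n]$; $\mathtt{partialSum}(r)$ is the sum of the $r$ smallest elements of $W$ (counted with multiplicity). A deferred data structure receives the unsorted input with no preprocessing and answers queries one at a time, each before the next is known, rearranging its data as needed; the stated time covers initialization and all $q$ queries. Logarithms are base 2.
   Formalization: The weights $W[1..n]$ are positive rationals, and the argument $x$ of each query $\mathtt{rank}(x)$ is rational. -}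

module Defs where

open import Data.Nat as ℕ using (ℕ; zero; suc; _+_)
open import Data.Fin using (Fin)
open import Data.Integer using (+_)
open import Data.Rational as ℚ using (ℚ; 0ℚ; _/_)
open import Data.Rational.Properties using (≤-decTotalOrder; _<?_; _≟_)
open import Data.List as List using (List; []; _∷_; length; filter; take)
open import Data.Vec as Vec using (Vec; []; _∷_; _++_; _∷ʳ_; lookup; toList)
open import Data.Product using (_×_; _,_)
open import Relation.Nullary using (yes; no)

open import Data.List.Sort ≤-decTotalOrder using (sort)

-- Computational model: algebraic decision trees.
-- Inputs are real (here: rational) variables x_0 .. x_{m-1}.
-- Arithmetic is free; each sign test of a polynomial in the inputs
-- costs one unit.

data Expr (m : ℕ) : Set where
  var  : Fin m → Expr m
  con  : ℚ → Expr m
  _⊕_  : Expr m → Expr m → Expr m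
  _⊗_  : Expr m → Expr m → Expr m
  neg  : Expr m → Expr m

eval : ∀ {m} → (Fin m → ℚ) → Expr m → ℚ
eval ρ (var i) = ρ i
eval ρ (con c) = c
eval ρ (e ⊕ f) = eval ρ e ℚ.+ eval ρ f
eval ρ (e ⊗ f) = eval ρ e ℚ.* eval ρ f
eval ρ (neg e) = ℚ.- eval ρ e

data Sign : Set where
  neg< zero= pos> : Sign

sign : ℚ → Sign
sign v with v <? 0ℚ
... | yes _ = neg<
... | no _ with v ≟ 0ℚ
...   | yes _ = zero=
...   | no _  = pos>

data Tree (m : ℕ) (A : Set) : Set where
  leaf : A → Tree m A
  test : Expr m → (Sign → Tree m A) → Tree m A

runTree : ∀ {m} {A : Set} → (Fin m → ℚ) → Tree m A → A × ℕ
runTree ρ (leaf a) = a , 0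
runTree ρ (test p k) with runTree ρ (k (sign (eval ρ p)))
... | a , c = a , suc c

-- Queries on the multiset W of n weights.
-- rank x  : the real argument x is supplied as an input variable;
-- select r: r : Fin n stands for rank r+1 (r ∈ [1..n]);
-- partialSum r : r ∈ [0..n].

data Query (n : ℕ) : Set where
  rank       : Query n
  select     : Fin n → Query n
  partialSum : Fin (suc n) → Query n

-- Before the k-th query (k = 0,1,..) its input variables are W[0..n-1]
-- followed by the real arguments of the k+1 queries seen so far (the
-- current one included; 0 for queries without a real argument).  The state can only record query data and
-- test outcomes; no knowledge of future queries (nor of their number)
-- is available.
record DS (n : ℕ) : Set₁ where
  field
    State : Set
    init  : State
    step  : (k : ℕ) → State → Query n →
            Tree (n + suc k) (Expr (n + suc k) × State)
open DS public

runFrom : ∀ {n k} (d : DS n) → State d → Vec ℚ n → Vec ℚ k →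
          List (Query n × ℚ) → List ℚ × ℕ
runFrom d s W xs [] = [] , 0
runFrom {k = k} d s W xs ((qr , x) ∷ rest)
  with runTree (lookup (W ++ (xs ∷ʳ x))) (step d k s qr)
... | (e , s') , c with runFrom d s' W (xs ∷ʳ x) rest
...   | as , c' = eval (lookup (W ++ (xs ∷ʳ x))) e ∷ as , c + c'

run : ∀ {n} (d : DS n) → Vec ℚ n → List (Query n × ℚ) → List ℚ × ℕ
run d W qs = runFrom d (init d) W [] qs

fromℕ : ℕ → ℚ
fromℕ m = (+ m) / 1

sumℚ : List ℚ → ℚ
sumℚ = List.foldr ℚ._+_ 0ℚ

nth : ℕ → List ℚ → ℚ
nth _ [] = 0ℚ
nth zero (x ∷ _) = x
nth (suc i) (_ ∷ xs) = nth i xs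

rankSpec : ∀ {n} → Vec ℚ n → ℚ → ℕ
rankSpec W x = length (filter (_<? x) (toList W))

-- r-th smallest (r = toℕ i + 1), with multiplicity
selectSpec : ∀ {n} → Vec ℚ n → Fin n → ℚ
selectSpec W i = nth (Data.Fin.toℕ i) (sort (toList W))

partialSumSpec : ∀ {n} → Vec ℚ n → Fin (suc n) → ℚ
partialSumSpec W r = sumℚ (take (Data.Fin.toℕ r) (sort (toList W)))

answer : ∀ {n} → Vec ℚ n → Query n × ℚ → ℚ
answer W (rank , x) = fromℕ (rankSpec W x)
answer W (select i , _) = selectSpec W i
answer W (partialSum r , _) = partialSumSpec W r

{-# OPTIONS --safe #-}
module Submission where

-- The weights are kept in a partition tree: an internal node holds a pivot, the weights equal to it,
-- and the subtrees of smaller and of larger weights; leaves are unsorted buckets. When the number of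
-- queries seen reaches a power of two 2^j, every bucket is split at its median, found by linear-time
-- (median-of-medians) selection, so a refinement costs O(n) tests and leaves buckets of at most n/2^j
-- weights. A query descends the balanced tree with at most 1 + ⌊log n⌋ tests and then does linear work
-- in a single bucket, O(n/2^j). The at most 2^j queries of phase j thus cost O(n) beyond their descents,
-- and q queries span 1 + ⌊log q⌋ phases.

open import Defs
open import Data.Nat as ℕ using (ℕ; zero; suc; _+_; _*_; _∸_; _≤_; _<_; z≤n; s≤s; _⊔_; ⌊_/2⌋; ⌈_/2⌉; _^_)
import Data.Nat.Properties as ℕₚ
open import Data.Nat.Logarithm using (⌊log₂_⌋; ⌊log₂⌋-mono-≤; ⌊log₂[2^n]⌋≡n)
open import Data.Nat.Tactic.RingSolver using (solve-∀)
import Data.List.Relation.Unary.Linked.Properties as Linkedₚ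
open import Data.Rational as ℚ using (ℚ; Positive; 0ℚ)
import Data.Rational.Properties as ℚₚ
open import Data.List.Sort ℚₚ.≤-decTotalOrder using (sort; sort-↭; sort-↗)
open import Data.Fin as Fin using (Fin)
open import Data.Vec as Vec using (Vec)
import Data.Vec.Properties as Vecₚ
import Data.Fin.Properties as Finₚ
open import Data.Vec.Relation.Unary.All using (All)
open import Data.List using (List; []; _∷_; length; map; filter; take; replicate; concat; _++_)
import Data.List.Properties as Listₚ
open import Data.List.Relation.Unary.All as ListAll using ([]; _∷_)
import Data.List.Relation.Unary.All.Properties as ListAllₚ
open import Data.List.Relation.Unary.AllPairs using (AllPairs; []; _∷_)
open import Data.List.Relation.Unary.Any using (here; there)
open import Data.List.Relation.Binary.Pointwise as Pointwise using (Pointwise; []; _∷_)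
open import Data.List.Membership.Propositional using (_∈_)
open import Data.List.Membership.Propositional.Properties using (∈-++⁺ˡ; ∈-++⁺ʳ; ∈-++⁻)
open import Data.List.Relation.Binary.Permutation.Propositional
  using (_↭_; ↭-refl; ↭-sym; ↭-trans; ↭-prep; ↭-reflexive; ↭⇒↭ₛ)
import Data.List.Relation.Binary.Permutation.Propositional.Properties as ↭ₚ
import Data.List.Relation.Binary.Permutation.Setoid.Properties as ↭ₛₚ
open import Data.Product using (Σ; _×_; proj₁; proj₂; _,_)
open import Data.Sum using (inj₁; inj₂)
open import Data.Empty using (⊥-elim)
open import Data.Unit using (⊤; tt)
open import Function using (_∘′_)
open import Relation.Nullary using (Dec; yes; no; ¬_)
open import Relation.Binary using (tri<; tri≈; tri>)
open import Relation.Binary.PropositionalEquality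
  using (_≡_; refl; sym; trans; cong; cong₂; subst; subst₂; setoid; module ≡-Reasoning)

variable
  m n : ℕ
  A B : Set

m≤n<m+o⇒0<o : ∀ {a r b} → a ≤ r → r < a + b → 0 < b
m≤n<m+o⇒0<o {a} {r} {zero}  a≤r r<a+0 = ⊥-elim (ℕₚ.≤⇒≯ a≤r (subst (r <_) (ℕₚ.+-identityʳ a) r<a+0))
m≤n<m+o⇒0<o {b = suc b} _ _ = s≤s z≤n

0<n⇒⌊n/2⌋<n : ∀ {g} → 0 < g → ⌊ g /2⌋ < g
0<n⇒⌊n/2⌋<n {suc g} _ = ℕₚ.⌊n/2⌋<n g

m∸n<m : ∀ {s k} → 0 < s → 0 < k → s ∸ k < s
m∸n<m {suc s} {suc k} _ _ = s≤s (ℕₚ.m∸n≤m s k)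

m+n≡o∧k≤n⇒m≤o∸k : ∀ {a b s k} → a + b ≡ s → k ≤ b → a ≤ s ∸ k
m+n≡o∧k≤n⇒m≤o∸k {a} {b} a+b≡s k≤b =
  ℕₚ.≤-trans (ℕₚ.≤-reflexive (sym (trans (cong (_∸ b) (sym a+b≡s)) (ℕₚ.m+n∸n≡m a b)))) (ℕₚ.∸-monoʳ-≤ _ k≤b)

m+n≡o∧m≤k⇒o∸k≤n : ∀ {a b s k} → a + b ≡ s → a ≤ k → s ∸ k ≤ b
m+n≡o∧m≤k⇒o∸k≤n {a} {b} a+b≡s a≤k =
  ℕₚ.≤-trans (ℕₚ.∸-monoʳ-≤ _ a≤k) (ℕₚ.≤-reflexive (trans (cong (_∸ a) (sym a+b≡s)) (ℕₚ.m+n∸m≡n a b)))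

⌈n/2⌉≡n∸⌊n/2⌋ : ∀ n → ⌈ n /2⌉ ≡ n ∸ ⌊ n /2⌋
⌈n/2⌉≡n∸⌊n/2⌋ n = trans (sym (ℕₚ.m+n∸m≡n ⌊ n /2⌋ ⌈ n /2⌉)) (cong (_∸ ⌊ n /2⌋) (ℕₚ.⌊n/2⌋+⌈n/2⌉≡n n))

2*⌊n/2⌋≤n : ∀ n → 2 * ⌊ n /2⌋ ≤ n
2*⌊n/2⌋≤n n = begin
  2 * ⌊ n /2⌋            ≡⟨ cong (⌊ n /2⌋ +_) (ℕₚ.+-identityʳ ⌊ n /2⌋) ⟩
  ⌊ n /2⌋ + ⌊ n /2⌋      ≤⟨ ℕₚ.+-monoʳ-≤ ⌊ n /2⌋ (ℕₚ.⌊n/2⌋≤⌈n/2⌉ n) ⟩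
  ⌊ n /2⌋ + ⌈ n /2⌉      ≡⟨ ℕₚ.⌊n/2⌋+⌈n/2⌉≡n n ⟩
  n                      ∎
  where open ℕₚ.≤-Reasoning

n<2*m⇒⌊n/2⌋<m : ∀ {n m} → n < 2 * m → ⌊ n /2⌋ < m
n<2*m⇒⌊n/2⌋<m {n} {m} n<2m = ℕₚ.*-cancelˡ-< 2 ⌊ n /2⌋ m (ℕₚ.≤-<-trans (2*⌊n/2⌋≤n n) n<2m)

n<2^[1+⌊log₂n⌋] : ∀ n → n < 2 ^ suc ⌊log₂ n ⌋
n<2^[1+⌊log₂n⌋] n = ℕₚ.≰⇒> λ 2^[1+log]≤n →
  ℕₚ.<-irrefl refl (ℕₚ.≤-trans (ℕₚ.≤-reflexive (sym (⌊log₂[2^n]⌋≡n (suc ⌊log₂ n ⌋)))) (⌊log₂⌋-mono-≤ 2^[1+log]≤n))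

m≤n⇒m+0≤n : ∀ {m n} → m ≤ n → m + 0 ≤ n
m≤n⇒m+0≤n {m} = subst (_≤ _) (sym (ℕₚ.+-identityʳ m))

lookup-∷ʳ-fromℕ : ∀ {k} (xs : Vec A k) x → Vec.lookup (xs Vec.∷ʳ x) (Fin.fromℕ k) ≡ x
lookup-∷ʳ-fromℕ Vec.[]       x = refl
lookup-∷ʳ-fromℕ (_ Vec.∷ xs) x = lookup-∷ʳ-fromℕ xs x

-- Decision trees

infixl 1 _>>=_

_>>=_ : Tree m A → (A → Tree m B) → Tree m B
leaf a   >>= f = f a
test e k >>= f = test e (λ s → k s >>= f)

mapM : (A → Tree m B) → List A → Tree m (List B)
mapM f []       = leaf []
mapM f (x ∷ xs) = f x >>= λ b → mapM f xs >>= λ bs → leaf (b ∷ bs)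

record WP (ρ : Fin m → ℚ) (t : Tree m A) (Q : A → ℕ → Set) : Set where
  constructor wp
  field unwp : Q (proj₁ (runTree ρ t)) (proj₂ (runTree ρ t))
open WP public

module _ {ρ : Fin m → ℚ} where

  wp-leaf : ∀ {a : A} {Q} → Q a 0 → WP ρ (leaf a) Q
  wp-leaf = wp

  wp-mono : ∀ {t : Tree m A} {P Q : A → ℕ → Set} → (∀ {a c} → P a c → Q a c) → WP ρ t P → WP ρ t Q
  wp-mono f (wp h) = wp (f h)

  wp-bind : ∀ {t : Tree m A} {f : A → Tree m B} {Q} →
            WP ρ t (λ a c → WP ρ (f a) (λ b c′ → Q b (c + c′))) → WP ρ (t >>= f) Q
  wp-bind {t = leaf a}   (wp (wp h)) = wp h
  wp-bind {t = test e k} {f} {Q} (wp h) =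
    wp (unwp (wp-bind {t = k (sign (eval ρ e))} {f} {λ b c → Q b (suc c)} (wp h)))

  wp-seq : ∀ {t : Tree m A} {f : A → Tree m B} {P Q} → WP ρ t P →
           (∀ a c → P a c → WP ρ (f a) (λ b c′ → Q b (c + c′))) → WP ρ (t >>= f) Q
  wp-seq h k = wp-bind (wp-mono (k _ _) h)

  wp-mapM : ∀ {f : A → Tree m B} {P : A → Set} {R : A → B → Set} {xs} k →
            (∀ {x} → P x → WP ρ (f x) (λ b c → R x b × c ≤ k)) → ListAll.All P xs →
            WP ρ (mapM f xs) (λ bs c → Pointwise R xs bs × c ≤ length xs * k)
  wp-mapM k run [] = wp-leaf ([] , z≤n)
  wp-mapM k run (px ∷ pxs) =
    wp-seq (run px) λ _ c (r , c≤k) →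
    wp-seq (wp-mapM k run pxs) λ _ c′ (rs , c′≤) →
    wp-leaf (r ∷ rs , ℕₚ.+-mono-≤ c≤k (m≤n⇒m+0≤n c′≤))

<⇒≱ : ∀ {a b} → a ℚ.< b → ¬ b ℚ.≤ a
<⇒≱ a<b b≤a = ℚₚ.<-irrefl refl (ℚₚ.<-≤-trans a<b b≤a)

data Compare (a b : ℚ) : Sign → Set where
  less    : a ℚ.< b → Compare a b neg<
  equal   : a ≡ b   → Compare a b zero=
  greater : b ℚ.< a → Compare a b pos>

sign-neg : ∀ {v} → v ℚ.< 0ℚ → sign v ≡ neg<
sign-neg {v} v<0 with v ℚₚ.<? 0ℚ
... | yes _   = refl
... | no v≮0 = ⊥-elim (v≮0 v<0)

sign-pos : ∀ {v} → 0ℚ ℚ.< v → sign v ≡ pos>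
sign-pos {v} 0<v with v ℚₚ.<? 0ℚ
... | yes v<0 = ⊥-elim (ℚₚ.<-asym 0<v v<0)
... | no _ with v ℚₚ.≟ 0ℚ
...   | yes v≡0 = ⊥-elim (ℚₚ.<-irrefl (sym v≡0) 0<v)
...   | no _    = refl

compare-sign : ∀ a b → Compare a b (sign (a ℚ.- b))
compare-sign a b with ℚₚ.<-cmp a b
... | tri< a<b _ _ = subst (Compare a b) (sym (sign-neg a-b<0)) (less a<b)
  where
  a-b<0 : a ℚ.- b ℚ.< 0ℚ
  a-b<0 = subst (a ℚ.- b ℚ.<_) (ℚₚ.+-inverseʳ b) (ℚₚ.+-monoˡ-< (ℚ.- b) a<b)
... | tri≈ _ refl _ = subst (Compare a b) (cong sign (sym (ℚₚ.+-inverseʳ a))) (equal refl)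
... | tri> _ _ b<a = subst (Compare a b) (sym (sign-pos 0<a-b)) (greater b<a)
  where
  0<a-b : 0ℚ ℚ.< a ℚ.- b
  0<a-b = subst (ℚ._< a ℚ.- b) (ℚₚ.+-inverseʳ b) (ℚₚ.+-monoˡ-< (ℚ.- b) b<a)

_≶_ : Fin m → Fin m → Expr m
i ≶ j = var i ⊕ neg (var j)

wp-compare : ∀ {ρ : Fin m → ℚ} {i j a b} {k : Sign → Tree m A} {Q} → ρ i ≡ a → ρ j ≡ b →
             (∀ {s} → Compare a b s → WP ρ (k s) (λ x c → Q x (suc c))) → WP ρ (test (i ≶ j) k) Q
wp-compare {ρ = ρ} {i} {j} refl refl h = wp (unwp (h (compare-sign (ρ i) (ρ j))))

-- Order statistics

sumℚ-++ : ∀ xs ys → sumℚ (xs ++ ys) ≡ sumℚ xs ℚ.+ sumℚ ys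
sumℚ-++ []       ys = sym (ℚₚ.+-identityˡ (sumℚ ys))
sumℚ-++ (x ∷ xs) ys = trans (cong (x ℚ.+_) (sumℚ-++ xs ys)) (sym (ℚₚ.+-assoc x (sumℚ xs) (sumℚ ys)))

sumℚ-↭ : ∀ {xs ys} → xs ↭ ys → sumℚ xs ≡ sumℚ ys
sumℚ-↭ p = ↭ₛₚ.foldr-commMonoid (setoid ℚ) ℚₚ.+-0-isCommutativeMonoid (↭⇒↭ₛ p)

module _ {P : ℚ → Set} (P? : ∀ x → Dec (P x)) where

  count : List ℚ → ℕ
  count xs = length (filter P? xs)

  count-↭ : ∀ {xs ys} → xs ↭ ys → count xs ≡ count ys
  count-↭ p = ↭ₚ.↭-length (↭ₚ.filter-↭ P? p)

  count-accept : ∀ {x} xs → P x → count (x ∷ xs) ≡ suc (count xs)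
  count-accept xs px = cong length (Listₚ.filter-accept P? px)

  count-reject : ∀ {x} xs → ¬ P x → count (x ∷ xs) ≡ count xs
  count-reject xs ¬px = cong length (Listₚ.filter-reject P? ¬px)

  count-none : ∀ {xs} → ListAll.All (¬_ ∘′ P) xs → count xs ≡ 0
  count-none none = cong length (Listₚ.filter-none P? none)

  count-++ : ∀ xs ys → count (xs ++ ys) ≡ count xs + count ys
  count-++ xs ys = trans (cong length (Listₚ.filter-++ P? xs ys)) (Listₚ.length-++ (filter P? xs))

count-mono : ∀ {P Q : ℚ → Set} (P? : ∀ x → Dec (P x)) (Q? : ∀ x → Dec (Q x)) →
             (∀ {x} → P x → Q x) → ∀ xs → count P? xs ≤ count Q? xs
count-mono P? Q? P⇒Q []       = z≤n
count-mono {P} {Q} P? Q? P⇒Q (x ∷ xs) = cases (P? x) (Q? x)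
  where
  ih = count-mono P? Q? P⇒Q xs
  cases : Dec (P x) → Dec (Q x) → count P? (x ∷ xs) ≤ count Q? (x ∷ xs)
  cases (yes px) (yes qx) = subst₂ _≤_ (sym (count-accept P? xs px)) (sym (count-accept Q? xs qx)) (s≤s ih)
  cases (yes px) (no ¬qx) = ⊥-elim (¬qx (P⇒Q px))
  cases (no ¬px) (yes qx) = subst₂ _≤_ (sym (count-reject P? xs ¬px)) (sym (count-accept Q? xs qx))
                             (ℕₚ.m≤n⇒m≤1+n ih)
  cases (no ¬px) (no ¬qx) = subst₂ _≤_ (sym (count-reject P? xs ¬px)) (sym (count-reject Q? xs ¬qx)) ih

count< count≤ count≥ : ℚ → List ℚ → ℕ
count< v = count (ℚₚ._<? v)
count≤ v = count (ℚₚ._≤? v)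
count≥ v = count (v ℚₚ.≤?_)

sum< : ℚ → List ℚ → ℚ
sum< v xs = sumℚ (filter (ℚₚ._<? v) xs)

-- When u is an r-th smallest element of xs, the r smallest elements are those below u
-- and r ∸ count< u xs copies of u.
thresholdSum : ℚ → List ℚ → ℕ → ℚ
thresholdSum u xs r = sum< u xs ℚ.+ sumℚ (replicate (r ∸ count< u xs) u)

count<+count≥ : ∀ v xs → count< v xs + count≥ v xs ≡ length xs
count<+count≥ v []       = refl
count<+count≥ v (x ∷ xs) with x ℚₚ.<? v
... | yes x<v = trans (cong₂ _+_ (count-accept (ℚₚ._<? v) xs x<v) (count-reject (v ℚₚ.≤?_) xs (<⇒≱ x<v)))
                    (cong suc (count<+count≥ v xs))
... | no x≮v  = trans (cong₂ _+_ (count-reject (ℚₚ._<? v) xs x≮v) (count-accept (v ℚₚ.≤?_) xs (ℚₚ.≮⇒≥ x≮v)))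
                    (trans (ℕₚ.+-suc (count< v xs) (count≥ v xs)) (cong suc (count<+count≥ v xs)))

tally : Sign → ℕ → ℕ
tally neg< c = suc c
tally _    c = c

count<-∷ : ∀ {y a s} xs → Compare y a s → count< a (y ∷ xs) ≡ tally s (count< a xs)
count<-∷ {a = a} xs (less y<a)    = count-accept (ℚₚ._<? a) xs y<a
count<-∷ {a = a} xs (equal y≡a)   = count-reject (ℚₚ._<? a) xs (ℚₚ.<-irrefl y≡a)
count<-∷ {a = a} xs (greater a<y) = count-reject (ℚₚ._<? a) xs (ℚₚ.<-asym a<y)

sum<-none : ∀ {v xs} → ListAll.All (v ℚ.≤_) xs → sum< v xs ≡ 0ℚ
sum<-none {v} ge = cong sumℚ (Listₚ.filter-none (ℚₚ._<? v) (ListAll.map (λ v≤x x<v → <⇒≱ x<v v≤x) ge))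

count<-none : ∀ {v xs} → ListAll.All (v ℚ.≤_) xs → count< v xs ≡ 0
count<-none {v} ge = count-none (ℚₚ._<? v) (ListAll.map (λ v≤x x<v → <⇒≱ x<v v≤x) ge)

count≤-none : ∀ {v xs} → ListAll.All (v ℚ.<_) xs → count≤ v xs ≡ 0
count≤-none {v} gt = count-none (ℚₚ._≤? v) (ListAll.map <⇒≱ gt)

record Selected (xs : List ℚ) (r : ℕ) (u : ℚ) : Set where
  constructor selected
  field
    member : u ∈ xs
    lower  : count< u xs ≤ r
    upper  : r < count≤ u xs

record PrefixSum (xs : List ℚ) (r : ℕ) (s : ℚ) : Set where
  constructor prefixSum
  field
    threshold : ℚ
    member    : threshold ∈ xs
    lower     : count< threshold xs ≤ r
    upper     : r ≤ count≤ threshold xs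
    value     : s ≡ thresholdSum threshold xs r

Sorted : List ℚ → Set
Sorted = AllPairs ℚ._≤_

above-head : ∀ {u y xs} → u ℚ.< y → ListAll.All (y ℚ.≤_) xs → ListAll.All (u ℚ.<_) (y ∷ xs)
above-head u<y y≤xs = u<y ∷ ListAll.map (ℚₚ.<-≤-trans u<y) y≤xs

nth-sorted : ∀ {xs r u} → Sorted xs → count< u xs ≤ r → r < count≤ u xs → nth r xs ≡ u
nth-sorted {y ∷ xs} {r} {u} (y≤xs ∷ sorted) lower upper with ℚₚ.<-cmp y u | r
... | tri< y<u _ _ | zero  = ⊥-elim (ℕₚ.≤⇒≯ lower (subst (0 <_) (sym (count-accept (ℚₚ._<? u) xs y<u)) (s≤s z≤n)))
... | tri< y<u _ _ | suc r = nth-sorted sorted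
  (ℕₚ.≤-pred (subst (_≤ suc r) (count-accept (ℚₚ._<? u) xs y<u) lower))
  (ℕₚ.≤-pred (subst (suc r <_) (count-accept (ℚₚ._≤? u) xs (ℚₚ.<⇒≤ y<u)) upper))
... | tri≈ _ refl _ | zero  = refl
... | tri≈ _ refl _ | suc r = nth-sorted sorted
  (subst (_≤ r) (sym (count<-none y≤xs)) z≤n)
  (ℕₚ.≤-pred (subst (suc r <_) (count-accept (ℚₚ._≤? y) xs ℚₚ.≤-refl) upper))
... | tri> _ _ u<y | r     = ⊥-elim (ℕₚ.n≮0 (subst (r <_) (count≤-none (above-head u<y y≤xs)) upper))

sum<-accept : ∀ {u y} xs → y ℚ.< u → sum< u (y ∷ xs) ≡ y ℚ.+ sum< u xs
sum<-accept {u} xs y<u = cong sumℚ (Listₚ.filter-accept (ℚₚ._<? u) y<u)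

thresholdSum-minimum : ∀ {y xs} r → ListAll.All (y ℚ.≤_) xs → thresholdSum y xs r ≡ sumℚ (replicate r y)
thresholdSum-minimum {y} {xs} r y≤xs =
  trans (cong₂ (λ a c → a ℚ.+ sumℚ (replicate (r ∸ c) y)) (sum<-none y≤xs) (count<-none y≤xs)) (ℚₚ.+-identityˡ _)

sum-take-sorted : ∀ {xs r u} → Sorted xs → count< u xs ≤ r → r ≤ count≤ u xs → sumℚ (take r xs) ≡ thresholdSum u xs r
sum-take-sorted {[]} {zero} _ _ _ = refl
sum-take-sorted {y ∷ xs} {r} {u} (y≤xs ∷ sorted) lower upper with ℚₚ.<-cmp y u | r
... | tri< y<u _ _ | zero  = ⊥-elim (ℕₚ.≤⇒≯ lower (subst (0 <_) (sym c<) (s≤s z≤n)))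
  where c< = count-accept (ℚₚ._<? u) xs y<u
... | tri< y<u _ _ | suc r = begin
  y ℚ.+ sumℚ (take r xs)                       ≡⟨ cong (y ℚ.+_) (sum-take-sorted sorted
                                                     (ℕₚ.≤-pred (subst (_≤ suc r) c< lower))
                                                     (ℕₚ.≤-pred (subst (suc r ≤_) c≤ upper))) ⟩
  y ℚ.+ (sum< u xs ℚ.+ R (suc (count< u xs)))  ≡⟨ ℚₚ.+-assoc y (sum< u xs) _ ⟨
  (y ℚ.+ sum< u xs) ℚ.+ R (suc (count< u xs))  ≡⟨ cong₂ (λ a c → a ℚ.+ R c) (sym (sum<-accept xs y<u)) (sym c<) ⟩
  thresholdSum u (y ∷ xs) (suc r)              ∎
  where
  open ≡-Reasoning
  R : ℕ → ℚ
  R c = sumℚ (replicate (suc r ∸ c) u)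
  c< = count-accept (ℚₚ._<? u) xs y<u
  c≤ = count-accept (ℚₚ._≤? u) xs (ℚₚ.<⇒≤ y<u)
... | tri≈ _ refl _ | zero  = sym (thresholdSum-minimum 0 (ℚₚ.≤-refl ∷ y≤xs))
... | tri≈ _ refl _ | suc r = begin
  y ℚ.+ sumℚ (take r xs)             ≡⟨ cong (y ℚ.+_) (trans (sum-take-sorted sorted
                                           (subst (_≤ r) (sym (count<-none y≤xs)) z≤n)
                                           (ℕₚ.≤-pred (subst (suc r ≤_) (count-accept (ℚₚ._≤? y) xs ℚₚ.≤-refl) upper)))
                                         (thresholdSum-minimum r y≤xs)) ⟩
  sumℚ (replicate (suc r) y)         ≡⟨ thresholdSum-minimum (suc r) (ℚₚ.≤-refl ∷ y≤xs) ⟨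
  thresholdSum y (y ∷ xs) (suc r)    ∎
  where open ≡-Reasoning
... | tri> _ _ u<y | r with ℕₚ.n≤0⇒n≡0 (subst (r ≤_) (count≤-none (above-head u<y y≤xs)) upper)
...   | refl = sym (thresholdSum-minimum 0 (ListAll.map ℚₚ.<⇒≤ (above-head u<y y≤xs)))

-- Splitting around a pivot

module _ {I : Set} (w : I → ℚ) where

  record Split (v : ℚ) (S L E R : List I) : Set where
    constructor split
    field
      perm  : S ↭ L ++ E ++ R
      below : ListAll.All (λ i → w i ℚ.< v) L
      at    : ListAll.All (λ i → w i ≡ v) E
      above : ListAll.All (λ i → v ℚ.< w i) R

  split-[] : ∀ {v} → Split v [] [] [] []
  split-[] = split ↭-refl [] [] []

  module _ {v : ℚ} {i : I} {S L E R : List I} (sp : Split v S L E R) where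
    open Split sp

    split-∷-below : w i ℚ.< v → Split v (i ∷ S) (i ∷ L) E R
    split-∷-below i<v = split (↭-prep i perm) (i<v ∷ below) at above

    split-∷-at : w i ≡ v → Split v (i ∷ S) L (i ∷ E) R
    split-∷-at i≡v = split (↭-trans (↭-prep i perm) (↭-sym (↭ₚ.shift i L (E ++ R)))) below (i≡v ∷ at) above

    split-∷-above : v ℚ.< w i → Split v (i ∷ S) L E (i ∷ R)
    split-∷-above v<i = split (↭-trans (↭-prep i perm) (↭-sym (↭-trans (↭ₚ.++⁺ˡ L (↭ₚ.shift i E R))
                                                                      (↭ₚ.shift i L (E ++ R)))))
                              below at (v<i ∷ above)

  split-resp : ∀ {v S L E R L′ R′} → Split v S L E R → L ↭ L′ → R ↭ R′ → Split v (L′ ++ E ++ R′) L′ E R′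
  split-resp (split _ below at above) L↭L′ R↭R′ =
    split ↭-refl (↭ₚ.All-resp-↭ L↭L′ below) at (↭ₚ.All-resp-↭ R↭R′ above)

  module _ {v S L E R} (sp : Split v S L E R) where
    open Split sp

    private
      vals : List I → List ℚ
      vals = map w

      vals-perm : vals S ↭ vals L ++ vals E ++ vals R
      vals-perm = ↭-trans (↭ₚ.map⁺ w perm)
                    (↭-reflexive (trans (Listₚ.map-++ w L (E ++ R)) (cong (vals L ++_) (Listₚ.map-++ w E R))))

    length-split : length S ≡ length L + length E + length R
    length-split = begin
      length S                           ≡⟨ ↭ₚ.↭-length perm ⟩
      length (L ++ E ++ R)               ≡⟨ Listₚ.length-++ L ⟩
      length L + length (E ++ R)         ≡⟨ cong (length L +_) (Listₚ.length-++ E) ⟩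
      length L + (length E + length R)   ≡⟨ ℕₚ.+-assoc (length L) _ _ ⟨
      length L + length E + length R     ∎
      where open ≡-Reasoning

    module _ {P : ℚ → Set} (P? : ∀ x → Dec (P x)) where

      filter-split : filter P? (vals S) ↭ filter P? (vals L) ++ filter P? (vals E) ++ filter P? (vals R)
      filter-split = ↭-trans (↭ₚ.filter-↭ P? vals-perm) (↭-reflexive (trans (Listₚ.filter-++ P? (vals L) _)
                       (cong (filter P? (vals L) ++_) (Listₚ.filter-++ P? (vals E) (vals R)))))

      filter-split-below : (∀ {x} → v ℚ.≤ x → ¬ P x) → filter P? (vals S) ↭ filter P? (vals L)
      filter-split-below ¬P = ↭-trans filter-split (↭-reflexive (trans
        (cong₂ (λ e r → filter P? (vals L) ++ e ++ r)
          (Listₚ.filter-none P? (ListAllₚ.map⁺ (ListAll.map (λ i≡v → ¬P (ℚₚ.≤-reflexive (sym i≡v))) at)))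
          (Listₚ.filter-none P? (ListAllₚ.map⁺ (ListAll.map (λ v<i → ¬P (ℚₚ.<⇒≤ v<i)) above))))
        (Listₚ.++-identityʳ (filter P? (vals L)))))

      filter-split-above : (∀ {x} → x ℚ.≤ v → P x) → filter P? (vals S) ↭ vals L ++ vals E ++ filter P? (vals R)
      filter-split-above P = ↭-trans filter-split (↭-reflexive
        (cong₂ (λ l e → l ++ e ++ filter P? (vals R))
          (Listₚ.filter-all P? (ListAllₚ.map⁺ (ListAll.map (λ i<v → P (ℚₚ.<⇒≤ i<v)) below)))
          (Listₚ.filter-all P? (ListAllₚ.map⁺ (ListAll.map (λ i≡v → P (ℚₚ.≤-reflexive i≡v)) at)))))

      count-split-below : (∀ {x} → v ℚ.≤ x → ¬ P x) → count P? (vals S) ≡ count P? (vals L)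
      count-split-below ¬P = ↭ₚ.↭-length (filter-split-below ¬P)

      count-split-above : (∀ {x} → x ℚ.≤ v → P x) → count P? (vals S) ≡ length L + length E + count P? (vals R)
      count-split-above P = begin
        count P? (vals S)                                           ≡⟨ ↭ₚ.↭-length (filter-split-above P) ⟩
        length (vals L ++ vals E ++ filter P? (vals R))             ≡⟨ Listₚ.length-++ (vals L) ⟩
        length (vals L) + length (vals E ++ filter P? (vals R))
          ≡⟨ cong (length (vals L) +_) (Listₚ.length-++ (vals E)) ⟩
        length (vals L) + (length (vals E) + count P? (vals R))     ≡⟨ ℕₚ.+-assoc (length (vals L)) _ _ ⟨
        length (vals L) + length (vals E) + count P? (vals R)       ≡⟨ cong₂ (λ a b → a + b + count P? (vals R))
                                                                         (Listₚ.length-map w L) (Listₚ.length-map w E) ⟩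
        length L + length E + count P? (vals R)                     ∎
        where open ≡-Reasoning

    count<-split : count< v (vals S) ≡ length L
    count<-split = trans (count-split-below (ℚₚ._<? v) (λ v≤x x<v → <⇒≱ x<v v≤x))
                         (trans (cong length (Listₚ.filter-all (ℚₚ._<? v) (ListAllₚ.map⁺ below)))
                                (Listₚ.length-map w L))

    count≤-split : count≤ v (vals S) ≡ length L + length E
    count≤-split = trans (count-split-above (ℚₚ._≤? v) (λ x≤v → x≤v))
                         (trans (cong (length L + length E +_) (count≤-none (ListAllₚ.map⁺ above)))
                                (ℕₚ.+-identityʳ _))

    sum<-split : sum< v (vals S) ≡ sumℚ (vals L)
    sum<-split = trans (sumℚ-↭ (filter-split-below (ℚₚ._<? v) (λ v≤x x<v → <⇒≱ x<v v≤x)))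
                       (cong sumℚ (Listₚ.filter-all (ℚₚ._<? v) (ListAllₚ.map⁺ below)))

    ∈-split-left : ∀ {u} → u ∈ vals L → u ∈ vals S
    ∈-split-left u∈L = ↭ₚ.∈-resp-↭ (↭-sym vals-perm) (∈-++⁺ˡ u∈L)

    ∈-split-pivot : 0 < length E → v ∈ vals S
    ∈-split-pivot E≢[] = ↭ₚ.∈-resp-↭ (↭-sym vals-perm) (∈-++⁺ʳ (vals L) (∈-++⁺ˡ (∈-equals E≢[] at)))
      where
      ∈-equals : ∀ {E} → 0 < length E → ListAll.All (λ i → w i ≡ v) E → v ∈ vals E
      ∈-equals _ (i≡v ∷ _) = here (sym i≡v)

    ∈-split-right : ∀ {u} → u ∈ vals R → u ∈ vals S
    ∈-split-right u∈R = ↭ₚ.∈-resp-↭ (↭-sym vals-perm) (∈-++⁺ʳ (vals L) (∈-++⁺ʳ (vals E) u∈R))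

    module _ {u} (u≤v : u ℚ.≤ v) where

      count<-left : count< u (vals S) ≡ count< u (vals L)
      count<-left = count-split-below (ℚₚ._<? u) (λ v≤x x<u → <⇒≱ x<u (ℚₚ.≤-trans u≤v v≤x))

      sum<-left : sum< u (vals S) ≡ sum< u (vals L)
      sum<-left = sumℚ-↭ (filter-split-below (ℚₚ._<? u) (λ v≤x x<u → <⇒≱ x<u (ℚₚ.≤-trans u≤v v≤x)))

    count≤-left : ∀ {u} → u ℚ.< v → count≤ u (vals S) ≡ count≤ u (vals L)
    count≤-left u<v = count-split-below (ℚₚ._≤? _) (λ v≤x x≤u → <⇒≱ (ℚₚ.≤-<-trans x≤u u<v) v≤x)

    module _ {u} (v<u : v ℚ.< u) where

      count<-right : count< u (vals S) ≡ length L + length E + count< u (vals R)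
      count<-right = count-split-above (ℚₚ._<? u) (λ x≤v → ℚₚ.≤-<-trans x≤v v<u)

      count≤-right : count≤ u (vals S) ≡ length L + length E + count≤ u (vals R)
      count≤-right = count-split-above (ℚₚ._≤? u) (λ x≤v → ℚₚ.<⇒≤ (ℚₚ.≤-<-trans x≤v v<u))

      sum<-right : sum< u (vals S) ≡ sumℚ (vals L) ℚ.+ (sumℚ (vals E) ℚ.+ sum< u (vals R))
      sum<-right = trans (sumℚ-↭ (filter-split-above (ℚₚ._<? u) (λ x≤v → ℚₚ.≤-<-trans x≤v v<u)))
                     (trans (sumℚ-++ (vals L) _) (cong (sumℚ (vals L) ℚ.+_) (sumℚ-++ (vals E) _)))

    sides-< : 0 < length E → length L < length S × length R < length S
    sides-< 0<E =
      ℕₚ.<-≤-trans (ℕₚ.m<m+n (length L) 0<E)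
                   (ℕₚ.≤-trans (ℕₚ.m≤m+n _ (length R)) (ℕₚ.≤-reflexive (sym length-split))) ,
      subst (length R <_) (sym length-split) (ℕₚ.m<n+m (length R) (ℕₚ.≤-trans 0<E (ℕₚ.m≤n+m (length E) (length L))))

    rank-right : ∀ {r r′} → length L + length E + r′ ≡ r → r < length S → r′ < length R
    rank-right {r′ = r′} r≡ r<S =
      ℕₚ.+-cancelˡ-< (length L + length E) r′ (length R) (subst₂ _<_ (sym r≡) length-split r<S)

    length-below : length L + count≥ v (vals S) ≡ length S
    length-below = begin
      length L + count≥ v (vals S)             ≡⟨ cong (_+ count≥ v (vals S)) count<-split ⟨
      count< v (vals S) + count≥ v (vals S)    ≡⟨ count<+count≥ v (vals S) ⟩
      length (vals S)                          ≡⟨ Listₚ.length-map w S ⟩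
      length S                                 ∎
      where open ≡-Reasoning

    length-above : length R + count≤ v (vals S) ≡ length S
    length-above = trans (cong (length R +_) count≤-split) (trans (ℕₚ.+-comm (length R) _) (sym length-split))

    below-of : ∀ {u} → u ∈ vals L → u ℚ.< v
    below-of u∈L = ListAll.lookup (ListAllₚ.map⁺ below) u∈L

    above-of : ∀ {u} → u ∈ vals R → v ℚ.< u
    above-of u∈R = ListAll.lookup (ListAllₚ.map⁺ above) u∈R

    pivot-∈ : v ∈ vals S → 0 < length E
    pivot-∈ v∈S with ∈-++⁻ (vals L) (↭ₚ.∈-resp-↭ vals-perm v∈S)
    ... | inj₁ v∈L = ⊥-elim (ℚₚ.<-irrefl refl (below-of v∈L))
    ... | inj₂ v∈E++R with ∈-++⁻ (vals E) v∈E++R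
    ...   | inj₂ v∈R = ⊥-elim (ℚₚ.<-irrefl refl (above-of v∈R))
    ...   | inj₁ v∈E = subst (0 <_) (Listₚ.length-map w E) (nonempty v∈E)
      where
      nonempty : ∀ {x : ℚ} {xs} → x ∈ xs → 0 < length xs
      nonempty (here _)  = s≤s z≤n
      nonempty (there _) = s≤s z≤n

    selected-left : ∀ {r u} → Selected (vals L) r u → Selected (vals S) r u
    selected-left {r} (selected u∈L lower upper) = selected (∈-split-left u∈L)
      (subst (_≤ r) (sym (count<-left (ℚₚ.<⇒≤ (below-of u∈L)))) lower)
      (subst (r <_) (sym (count≤-left (below-of u∈L))) upper)

    selected-pivot : ∀ {r} → length L ≤ r → r < length L + length E → Selected (vals S) r v
    selected-pivot {r} L≤r r<L+E = selected (∈-split-pivot (m≤n<m+o⇒0<o L≤r r<L+E))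
      (subst (_≤ r) (sym count<-split) L≤r) (subst (r <_) (sym count≤-split) r<L+E)

    selected-right : ∀ {r u} → Selected (vals R) r u → Selected (vals S) (length L + length E + r) u
    selected-right {r} (selected u∈R lower upper) = selected (∈-split-right u∈R)
      (subst (_≤ _) (sym (count<-right (above-of u∈R))) (ℕₚ.+-monoʳ-≤ (length L + length E) lower))
      (subst (_ <_) (sym (count≤-right (above-of u∈R))) (ℕₚ.+-monoʳ-< (length L + length E) upper))

    prefixSum-left : ∀ {r s} → PrefixSum (vals L) r s → PrefixSum (vals S) r s
    prefixSum-left {r} (prefixSum u u∈L lower upper value) = prefixSum u (∈-split-left u∈L)
      (subst (_≤ r) (sym (count<-left (ℚₚ.<⇒≤ u<v))) lower) (subst (r ≤_) (sym (count≤-left u<v)) upper)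
      (trans value (cong₂ (λ a c → a ℚ.+ sumℚ (replicate (r ∸ c) u))
                          (sym (sum<-left (ℚₚ.<⇒≤ u<v))) (sym (count<-left (ℚₚ.<⇒≤ u<v)))))
      where u<v = below-of u∈L

    prefixSum-pivot : ∀ {r} → length L < r → r ≤ length L + length E →
                      PrefixSum (vals S) r (sumℚ (vals L) ℚ.+ sumℚ (replicate (r ∸ length L) v))
    prefixSum-pivot {r} L<r r≤L+E = prefixSum v (∈-split-pivot (m≤n<m+o⇒0<o L<r (s≤s r≤L+E)))
      (subst (_≤ r) (sym count<-split) (ℕₚ.<⇒≤ L<r)) (subst (r ≤_) (sym count≤-split) r≤L+E)
      (cong₂ (λ a c → a ℚ.+ sumℚ (replicate (r ∸ c) v)) (sym sum<-split) (sym count<-split))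

    prefixSum-right : ∀ {r s} → PrefixSum (vals R) r s →
                      PrefixSum (vals S) (length L + length E + r) (sumℚ (vals L) ℚ.+ (sumℚ (vals E) ℚ.+ s))
    prefixSum-right {r} {s} (prefixSum u u∈R lower upper value) = prefixSum u (∈-split-right u∈R)
      (subst (_≤ a + r) (sym (count<-right v<u)) (ℕₚ.+-monoʳ-≤ a lower))
      (subst (a + r ≤_) (sym (count≤-right v<u)) (ℕₚ.+-monoʳ-≤ a upper))
      (begin
        ΣL ℚ.+ (ΣE ℚ.+ s)                                    ≡⟨ cong (λ t → ΣL ℚ.+ (ΣE ℚ.+ t)) value ⟩
        ΣL ℚ.+ (ΣE ℚ.+ (sum< u (vals R) ℚ.+ X))              ≡⟨ cong (ΣL ℚ.+_) (ℚₚ.+-assoc ΣE _ X) ⟨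
        ΣL ℚ.+ ((ΣE ℚ.+ sum< u (vals R)) ℚ.+ X)              ≡⟨ ℚₚ.+-assoc ΣL _ X ⟨
        (ΣL ℚ.+ (ΣE ℚ.+ sum< u (vals R))) ℚ.+ X              ≡⟨ cong₂ ℚ._+_ (sym (sum<-right v<u))
                                                                  (cong (λ k → sumℚ (replicate k u)) (sym shift)) ⟩
        thresholdSum u (vals S) (a + r)                      ∎)
      where
      open ≡-Reasoning
      a = length L + length E
      ΣL = sumℚ (vals L)
      ΣE = sumℚ (vals E)
      v<u = above-of u∈R
      X = sumℚ (replicate (r ∸ count< u (vals R)) u)
      shift : a + r ∸ count< u (vals S) ≡ r ∸ count< u (vals R)
      shift = trans (cong (a + r ∸_) (count<-right v<u)) (ℕₚ.[m+n]∸[m+o]≡n∸o a r (count< u (vals R)))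

module _ {xs ys : List ℚ} (xs↭ys : xs ↭ ys) where

  selected-↭ : ∀ {r u} → Selected xs r u → Selected ys r u
  selected-↭ {r} {u} (selected u∈xs lower upper) = selected (↭ₚ.∈-resp-↭ xs↭ys u∈xs)
    (subst (_≤ r) (count-↭ (ℚₚ._<? u) xs↭ys) lower) (subst (r <_) (count-↭ (ℚₚ._≤? u) xs↭ys) upper)

  prefixSum-↭ : ∀ {r s} → PrefixSum xs r s → PrefixSum ys r s
  prefixSum-↭ {r} (prefixSum u u∈xs lower upper value) = prefixSum u (↭ₚ.∈-resp-↭ xs↭ys u∈xs)
    (subst (_≤ r) c< lower) (subst (r ≤_) (count-↭ (ℚₚ._≤? u) xs↭ys) upper)
    (trans value (cong₂ (λ a c → a ℚ.+ sumℚ (replicate (r ∸ c) u)) (sumℚ-↭ (↭ₚ.filter-↭ (ℚₚ._<? u) xs↭ys)) c<))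
    where c< = count-↭ (ℚₚ._<? u) xs↭ys

nth-sorted-↭ : ∀ {xs ys r u} → Sorted ys → xs ↭ ys → Selected xs r u → nth r ys ≡ u
nth-sorted-↭ sorted xs↭ys sel with selected-↭ xs↭ys sel
... | selected _ lower upper = nth-sorted sorted lower upper

sum-take-sorted-↭ : ∀ {xs ys r s} → Sorted ys → xs ↭ ys → PrefixSum xs r s → s ≡ sumℚ (take r ys)
sum-take-sorted-↭ sorted xs↭ys ps with prefixSum-↭ xs↭ys ps
... | prefixSum _ _ lower upper value = trans value (sym (sum-take-sorted sorted lower upper))

byRank : ℕ → ℕ → ℕ → (ℕ → A) → A → (ℕ → A) → A
byRank a b r left mid right with r ℕ.<? a
... | yes _ = left r
... | no _ with r ℕ.<? a + b
...   | yes _ = mid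
...   | no _  = right (r ∸ (a + b))

byRank-elim : ∀ (P : A → Set) a b r {left mid right} → (r < a → P (left r)) → (a ≤ r → r < a + b → P mid) →
              (∀ r′ → a + b + r′ ≡ r → P (right r′)) → P (byRank a b r left mid right)
byRank-elim P a b r inL inE inR with r ℕ.<? a
... | yes r<a = inL r<a
... | no r≮a with r ℕ.<? a + b
...   | yes r<a+b = inE (ℕₚ.≮⇒≥ r≮a) r<a+b
...   | no r≮a+b  = inR (r ∸ (a + b)) (ℕₚ.m+[n∸m]≡n (ℕₚ.≮⇒≥ r≮a+b))

-- Median of medians

groups5 : List A → List (List A)
groups5 (a ∷ b ∷ c ∷ d ∷ e ∷ xs) = (a ∷ b ∷ c ∷ d ∷ e ∷ []) ∷ groups5 xs
groups5 _                         = []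

leftover5 : List A → List A
leftover5 (a ∷ b ∷ c ∷ d ∷ e ∷ xs) = leftover5 xs
leftover5 xs                        = xs

concat-groups5 : ∀ (xs : List A) → concat (groups5 xs) ++ leftover5 xs ≡ xs
concat-groups5 (a ∷ b ∷ c ∷ d ∷ e ∷ xs) = cong (λ ys → a ∷ b ∷ c ∷ d ∷ e ∷ ys) (concat-groups5 xs)
concat-groups5 []                = refl
concat-groups5 (_ ∷ [])          = refl
concat-groups5 (_ ∷ _ ∷ [])      = refl
concat-groups5 (_ ∷ _ ∷ _ ∷ [])  = refl
concat-groups5 (_ ∷ _ ∷ _ ∷ _ ∷ []) = refl

length-groups5 : ∀ (xs : List A) → 5 * length (groups5 xs) + length (leftover5 xs) ≡ length xs
length-groups5 (a ∷ b ∷ c ∷ d ∷ e ∷ xs) =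
  trans (five (length (groups5 xs)) (length (leftover5 xs))) (cong (5 +_) (length-groups5 xs))
  where
  five : ∀ g l → 5 * suc g + l ≡ 5 + (5 * g + l)
  five = solve-∀
length-groups5 []                   = refl
length-groups5 (_ ∷ [])             = refl
length-groups5 (_ ∷ _ ∷ [])         = refl
length-groups5 (_ ∷ _ ∷ _ ∷ [])     = refl
length-groups5 (_ ∷ _ ∷ _ ∷ _ ∷ []) = refl

leftover5≤4 : ∀ (xs : List A) → length (leftover5 xs) ≤ 4
leftover5≤4 (a ∷ b ∷ c ∷ d ∷ e ∷ xs) = leftover5≤4 xs
leftover5≤4 []                   = z≤n
leftover5≤4 (_ ∷ [])             = s≤s z≤n
leftover5≤4 (_ ∷ _ ∷ [])         = s≤s (s≤s z≤n)
leftover5≤4 (_ ∷ _ ∷ _ ∷ [])     = s≤s (s≤s (s≤s z≤n))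
leftover5≤4 (_ ∷ _ ∷ _ ∷ _ ∷ []) = s≤s (s≤s (s≤s (s≤s z≤n)))

groups5-length : ∀ (xs : List A) → ListAll.All (λ G → length G ≡ 5) (groups5 xs)
groups5-length (a ∷ b ∷ c ∷ d ∷ e ∷ xs) = refl ∷ groups5-length xs
groups5-length []                   = []
groups5-length (_ ∷ [])             = []
groups5-length (_ ∷ _ ∷ [])         = []
groups5-length (_ ∷ _ ∷ _ ∷ [])     = []
groups5-length (_ ∷ _ ∷ _ ∷ _ ∷ []) = []

count-representatives : ∀ {P : ℚ → Set} (P? : ∀ x → Dec (P x)) k {Gs us} →
                        Pointwise (λ G u → P u → k ≤ count P? G) Gs us → k * count P? us ≤ count P? (concat Gs)
count-representatives P? k [] = ℕₚ.≤-reflexive (ℕₚ.*-zeroʳ k)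
count-representatives {P} P? k {G ∷ Gs} {u ∷ us} (rep ∷ reps) = cases (P? u)
  where
  ih = count-representatives P? k reps
  cases : Dec (P u) → k * count P? (u ∷ us) ≤ count P? (G ++ concat Gs)
  cases (yes pu) = subst₂ _≤_ (sym (trans (cong (k *_) (count-accept P? us pu)) (ℕₚ.*-suc k _)))
                              (sym (count-++ P? G (concat Gs)))
                     (ℕₚ.+-mono-≤ (rep pu) ih)
  cases (no ¬pu) = subst₂ _≤_ (sym (cong (k *_) (count-reject P? us ¬pu))) (sym (count-++ P? G (concat Gs)))
                     (ℕₚ.≤-trans ih (ℕₚ.m≤n+m _ _))

groups5-nonempty : ∀ (xs : List A) → 4 < length xs → 0 < length (groups5 xs)
groups5-nonempty xs 4<xs with length (groups5 xs) in g≡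
... | suc _ = s≤s z≤n
... | zero  = ⊥-elim (ℕₚ.<⇒≱ 4<xs (subst (_≤ 4) (trans (cong (λ g → 5 * g + length (leftover5 xs)) (sym g≡))
                                                      (length-groups5 xs)) (leftover5≤4 xs)))

groups5-fewer : ∀ (xs : List A) → 0 < length (groups5 xs) → length (groups5 xs) < length xs
groups5-fewer xs 0<g = begin-strict
  g                                ≡⟨ ℕₚ.*-identityˡ g ⟨
  1 * g                            <⟨ ℕₚ.*-monoˡ-< g ⦃ ℕ.>-nonZero 0<g ⦄ {1} {5} (s≤s (s≤s z≤n)) ⟩
  5 * g                            ≤⟨ ℕₚ.m≤m+n (5 * g) (length (leftover5 xs)) ⟩
  5 * g + length (leftover5 xs)    ≡⟨ length-groups5 xs ⟩
  length xs                        ∎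
  where
  open ℕₚ.≤-Reasoning
  g = length (groups5 xs)

median5-above : ∀ {xs u v} → length xs ≡ 5 → Selected xs 2 u → v ℚ.≤ u → 3 ≤ count≥ v xs
median5-above {xs} {u} {v} xs≡5 (selected _ lower _) v≤u =
  ℕₚ.≤-trans (m+n≡o∧m≤k⇒o∸k≤n (trans (count<+count≥ u xs) xs≡5) lower)
             (count-mono (u ℚₚ.≤?_) (v ℚₚ.≤?_) (ℚₚ.≤-trans v≤u) xs)

median5-below : ∀ {xs u v} → Selected xs 2 u → u ℚ.≤ v → 3 ≤ count≤ v xs
median5-below {xs} {u} {v} (selected _ _ upper) u≤v =
  ℕₚ.≤-trans upper (count-mono (ℚₚ._≤? u) (ℚₚ._≤? v) (λ x≤u → ℚₚ.≤-trans x≤u u≤v) xs)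

selected-median : ∀ {xs u} → Selected xs ⌊ length xs /2⌋ u →
                  ⌈ length xs /2⌉ ≤ count≥ u xs × ⌈ length xs /2⌉ ≤ count≤ u xs
selected-median {xs} {u} (selected _ lower upper) =
  subst (_≤ count≥ u xs) (sym (⌈n/2⌉≡n∸⌊n/2⌋ (length xs))) (m+n≡o∧m≤k⇒o∸k≤n (count<+count≥ u xs) lower) ,
  ℕₚ.≤-trans (ℕₚ.⌊n/2⌋-mono (ℕₚ.n≤1+n (suc (length xs)))) upper

-- Lists of at most K elements are pivoted on their first element; K = 64 is large enough for the
-- median-of-medians recurrence to close with the linear bound K·s.
K : ℕ
K = 64

-- The quadratic bound for short lists is what makes each median of five cost at most 25 tests.
SelectCost : ℕ → ℕ → Set
SelectCost s c = c ≤ K * s × (s ≤ K → c ≤ s * s)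

selectCost-mono : ∀ {a b c} → SelectCost a c → a ≤ b → SelectCost b c
selectCost-mono (c≤Ka , c≤a²) a≤b =
  ℕₚ.≤-trans c≤Ka (ℕₚ.*-monoʳ-≤ K a≤b) , λ b≤K → ℕₚ.≤-trans (c≤a² (ℕₚ.≤-trans a≤b b≤K)) (ℕₚ.*-mono-≤ a≤b a≤b)

selectCost-small : ∀ {s c} → 0 < s → s ≤ K → SelectCost (s ∸ 1) c → SelectCost s (s + c)
selectCost-small {suc t} {c} _ s≤K (c≤Kt , c≤t²) =
  ℕₚ.≤-trans (ℕₚ.+-mono-≤ s≤K c≤Kt) (ℕₚ.≤-reflexive (sym (ℕₚ.*-suc K t))) ,
  λ _ → ℕₚ.+-monoʳ-≤ (suc t) (ℕₚ.≤-trans (c≤t² (ℕₚ.≤-trans (ℕₚ.n≤1+n t) s≤K)) (ℕₚ.*-monoʳ-≤ t (ℕₚ.n≤1+n t)))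

median-of-medians-overhead : ∀ {s g l} → 0 < g → 5 * g + l ≡ s → l ≤ 4 → g * 25 + K * g + s ≤ K * (3 * ⌈ g /2⌉)
median-of-medians-overhead {s} {g} {l} 0<g s≡5g+l l≤4 = begin
  g * 25 + K * g + s           ≤⟨ ℕₚ.+-monoʳ-≤ (g * 25 + K * g)
                                    (ℕₚ.≤-trans (ℕₚ.≤-reflexive (sym s≡5g+l)) (ℕₚ.+-monoʳ-≤ (5 * g) l≤4)) ⟩
  g * 25 + K * g + (5 * g + 4) ≡⟨ collect g ⟩
  94 * g + 4                   ≤⟨ ℕₚ.+-mono-≤ (ℕₚ.*-monoʳ-≤ 94 g≤2h) (ℕₚ.*-monoʳ-≤ 4 (ℕₚ.⌈n/2⌉-mono {1} 0<g)) ⟩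
  94 * (2 * h) + 4 * h         ≡⟨ regroup h ⟩
  K * (3 * h)                  ∎
  where
  open ℕₚ.≤-Reasoning
  h = ⌈ g /2⌉
  g≤2h : g ≤ 2 * h
  g≤2h = ℕₚ.≤-trans (ℕₚ.≤-reflexive (sym (ℕₚ.⌊n/2⌋+⌈n/2⌉≡n g)))
           (ℕₚ.≤-trans (ℕₚ.+-monoˡ-≤ h (ℕₚ.⌊n/2⌋≤⌈n/2⌉ g)) (ℕₚ.≤-reflexive (cong (h +_) (sym (ℕₚ.+-identityʳ h)))))
  collect : ∀ x → x * 25 + K * x + (5 * x + 4) ≡ 94 * x + 4
  collect = solve-∀
  regroup : ∀ x → 94 * (2 * x) + 4 * x ≡ K * (3 * x)
  regroup = solve-∀

3⌈g/2⌉≤s : ∀ {s g l} → 5 * g + l ≡ s → 3 * ⌈ g /2⌉ ≤ s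
3⌈g/2⌉≤s {s} {g} {l} s≡5g+l = begin
  3 * ⌈ g /2⌉      ≤⟨ ℕₚ.*-monoʳ-≤ 3 (ℕₚ.⌈n/2⌉≤n g) ⟩
  3 * g            ≤⟨ ℕₚ.*-monoˡ-≤ g {3} {5} (s≤s (s≤s (s≤s z≤n))) ⟩
  5 * g            ≤⟨ ℕₚ.m≤m+n (5 * g) l ⟩
  5 * g + l        ≡⟨ s≡5g+l ⟩
  s                ∎
  where open ℕₚ.≤-Reasoning

selectCost-big : ∀ {s g l c₁ c} → K < s → 0 < g → 5 * g + l ≡ s → l ≤ 4 → c₁ ≤ g * 25 + K * g →
                 SelectCost (s ∸ 3 * ⌈ g /2⌉) c → SelectCost s (c₁ + (s + c))
selectCost-big {s} {g} {l} {c₁} {c} K<s 0<g s≡5g+l l≤4 c₁≤ (c≤ , _) = bound , λ s≤K → ⊥-elim (ℕₚ.<⇒≱ K<s s≤K)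
  where
  open ℕₚ.≤-Reasoning
  h = ⌈ g /2⌉
  bound : c₁ + (s + c) ≤ K * s
  bound = begin
    c₁ + (s + c)                                 ≤⟨ ℕₚ.+-mono-≤ c₁≤ (ℕₚ.+-monoʳ-≤ s c≤) ⟩
    g * 25 + K * g + (s + K * (s ∸ 3 * h))       ≡⟨ ℕₚ.+-assoc (g * 25 + K * g) s _ ⟨
    g * 25 + K * g + s + K * (s ∸ 3 * h)         ≡⟨ cong (g * 25 + K * g + s +_) (ℕₚ.*-distribˡ-∸ K s (3 * h)) ⟩
    g * 25 + K * g + s + (K * s ∸ K * (3 * h))
      ≤⟨ ℕₚ.+-monoˡ-≤ _ (median-of-medians-overhead {g = g} 0<g s≡5g+l l≤4) ⟩
    K * (3 * h) + (K * s ∸ K * (3 * h))          ≡⟨ ℕₚ.m+[n∸m]≡n (ℕₚ.*-monoʳ-≤ K (3⌈g/2⌉≤s {g = g} s≡5g+l)) ⟩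
    K * s                                        ∎

-- Partition trees

Idx : ℕ → Set
Idx n = List (Fin n)

data PTree (n : ℕ) : Set where
  bucket : Idx n → PTree n
  node   : PTree n → Fin n → Idx n → PTree n → PTree n

content : PTree n → Idx n
content (bucket S)     = S
content (node l p e r) = content l ++ e ++ content r

size : PTree n → ℕ
size t = length (content t)

size-node : ∀ (l : PTree n) p e r → size (node l p e r) ≡ size l + (length e + size r)
size-node l p e r = trans (Listₚ.length-++ (content l)) (cong (size l +_) (Listₚ.length-++ e))

depth : PTree n → ℕ
depth (bucket _)     = 0
depth (node l _ _ r) = suc (depth l ⊔ depth r)

BucketsAtMost : ℕ → PTree n → Set
BucketsAtMost B (bucket S)     = length S ≤ B
BucketsAtMost B (node l _ _ r) = BucketsAtMost B l × BucketsAtMost B r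

Balanced : PTree n → Set
Balanced (bucket _)       = ⊤
Balanced t@(node l _ e r) = size l ≤ ⌊ size t /2⌋ × size r ≤ ⌊ size t /2⌋ × 0 < length e × Balanced l × Balanced r

BucketsAtMost-mono : ∀ {B B′} (t : PTree n) → B ≤ B′ → BucketsAtMost B t → BucketsAtMost B′ t
BucketsAtMost-mono (bucket S)     B≤B′ S≤B       = ℕₚ.≤-trans S≤B B≤B′
BucketsAtMost-mono (node l _ _ r) B≤B′ (bl , br) = BucketsAtMost-mono l B≤B′ bl , BucketsAtMost-mono r B≤B′ br

depth-balanced : ∀ (t : PTree n) k → Balanced t → size t < 2 ^ k → depth t ≤ k
depth-balanced (bucket _) k _ _ = z≤n
depth-balanced (node l p e r) zero (_ , _ , 0<e , _) t<1 =
  ⊥-elim (ℕₚ.<⇒≱ t<1 (ℕₚ.≤-trans 0<e (ℕₚ.≤-trans (ℕₚ.m≤m+n (length e) (size r))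
                                                    (ℕₚ.≤-trans (ℕₚ.m≤n+m _ (size l)) (ℕₚ.≤-reflexive (sym (size-node l p e r)))))))
depth-balanced (node l _ e r) (suc k) (l≤ , r≤ , _ , bl , br) t<2^1+k =
  s≤s (ℕₚ.⊔-lub (depth-balanced l k bl (ℕₚ.≤-<-trans l≤ t/2<2^k)) (depth-balanced r k br (ℕₚ.≤-<-trans r≤ t/2<2^k)))
  where t/2<2^k = n<2*m⇒⌊n/2⌋<m t<2^1+k

Part : ℕ → Set
Part n = Idx n × Idx n × Idx n

firstOr : Fin n → Idx n → Fin n
firstOr d []      = d
firstOr _ (i ∷ _) = i

place : Fin n → Sign → Part n → Part n
place i neg< (L , E , R) = i ∷ L , E , R
place i zero= (L , E , R) = L , i ∷ E , R
place i pos> (L , E , R) = L , E , i ∷ R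

module Weighted (w : Fin n → ℚ) where

  vals : Idx n → List ℚ
  vals = map w

  IsPartition : Fin n → Idx n → Part n → Set
  IsPartition p S (L , E , R) = Split w (w p) S L E R

  place-correct : ∀ {p i S s} t → Compare (w i) (w p) s → IsPartition p S t → IsPartition p (i ∷ S) (place i s t)
  place-correct _ (less i<p)    sp = split-∷-below w sp i<p
  place-correct _ (equal i≡p)   sp = split-∷-at w sp i≡p
  place-correct _ (greater p<i) sp = split-∷-above w sp p<i

  Median5 : Idx n → Fin n → Set
  Median5 G q = length G ≡ 5 × Selected (vals G) 2 (w q)

  module _ {Gs M} (meds : Pointwise Median5 Gs M) where

    count-medians : ∀ {P : ℚ → Set} (P? : ∀ x → Dec (P x)) →
                    (∀ {G q} → Median5 G q → P (w q) → 3 ≤ count P? (vals G)) →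
                    3 * count P? (vals M) ≤ count P? (vals (concat Gs))
    count-medians P? three = subst (3 * count P? (vals M) ≤_) (cong (count P?) (Listₚ.concat-map Gs))
      (count-representatives P? 3 (Pointwise.map⁺ vals w (Pointwise.map three meds)))

    medians-above : ∀ v → 3 * count≥ v (vals M) ≤ count≥ v (vals (concat Gs))
    medians-above v = count-medians (v ℚₚ.≤?_)
      λ {G} (G≡5 , sel) → median5-above (trans (Listₚ.length-map w G) G≡5) sel

    medians-below : ∀ v → 3 * count≤ v (vals M) ≤ count≤ v (vals (concat Gs))
    medians-below v = count-medians (ℚₚ._≤? v) λ (_ , sel) → median5-below sel

  count-groups5 : ∀ {P : ℚ → Set} (P? : ∀ x → Dec (P x)) S → count P? (vals (concat (groups5 S))) ≤ count P? (vals S)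
  count-groups5 P? S = begin
    count P? (vals G)                            ≤⟨ ℕₚ.m≤m+n _ _ ⟩
    count P? (vals G) + count P? (vals rest)     ≡⟨ count-++ P? (vals G) (vals rest) ⟨
    count P? (vals G ++ vals rest)               ≡⟨ cong (count P?) (Listₚ.map-++ w G rest) ⟨
    count P? (vals (G ++ rest))                  ≡⟨ cong (count P? ∘′ vals) (concat-groups5 S) ⟩
    count P? (vals S)                            ∎
    where
    open ℕₚ.≤-Reasoning
    G = concat (groups5 S)
    rest = leftover5 S

  median-of-medians-splits : ∀ {S M p} → Pointwise Median5 (groups5 S) M → Selected (vals M) ⌊ length M /2⌋ (w p) →
                             3 * ⌈ length (groups5 S) /2⌉ ≤ count≥ (w p) (vals S) ×
                             3 * ⌈ length (groups5 S) /2⌉ ≤ count≤ (w p) (vals S)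
  median-of-medians-splits {S} {M} {p} meds sel =
    ℕₚ.≤-trans (ℕₚ.*-monoʳ-≤ 3 (subst (λ k → ⌈ k /2⌉ ≤ count≥ (w p) (vals M)) M≡g (proj₁ halves)))
      (ℕₚ.≤-trans (medians-above meds (w p)) (count-groups5 (w p ℚₚ.≤?_) S)) ,
    ℕₚ.≤-trans (ℕₚ.*-monoʳ-≤ 3 (subst (λ k → ⌈ k /2⌉ ≤ count≤ (w p) (vals M)) M≡g (proj₂ halves)))
      (ℕₚ.≤-trans (medians-below meds (w p)) (count-groups5 (ℚₚ._≤? w p) S))
    where
    M≡g : length (vals M) ≡ length (groups5 S)
    M≡g = trans (Listₚ.length-map w M) (sym (Pointwise.Pointwise-length meds))
    halves = selected-median (subst (λ k → Selected (vals M) ⌊ k /2⌋ (w p)) (sym (Listₚ.length-map w M)) sel)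

  record GoodPivot (S : Idx n) (p : Fin n) (c : ℕ) : Set where
    constructor goodPivot
    field
      many-above : 3 * ⌈ length (groups5 S) /2⌉ ≤ count≥ (w p) (vals S)
      many-below : 3 * ⌈ length (groups5 S) /2⌉ ≤ count≤ (w p) (vals S)
      cost       : c ≤ length (groups5 S) * 25 + K * length (groups5 S)

  PivotPost : Idx n → Fin n → ℕ → Set
  PivotPost S p c = (length S ≤ K → w p ∈ vals S × c ≡ 0) × (K < length S → GoodPivot S p c)

  record Shrink (S L R : Idx n) (c₁ : ℕ) : Set where
    constructor shrink
    field
      bound   : ℕ
      left≤   : length L ≤ bound
      right≤  : length R ≤ bound
      smaller : bound < length S
      cost    : ∀ {c} → SelectCost bound c → SelectCost (length S) (c₁ + (length S + c))

  pivot-shrinks : ∀ {S p c₁ L E R} → 0 < length S → PivotPost S p c₁ → IsPartition p S (L , E , R) → Shrink S L R c₁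
  pivot-shrinks {S} 0<S (small , _) sp with length S ℕ.≤? K
  ... | yes S≤K with small S≤K
  ...   | p∈S , refl with sides-< w sp (pivot-∈ w sp p∈S)
  ...     | L<S , R<S =
    shrink (length S ∸ 1) (ℕₚ.<⇒≤pred L<S) (ℕₚ.<⇒≤pred R<S) (m∸n<m 0<S (s≤s z≤n)) (selectCost-small 0<S S≤K)
  pivot-shrinks {S} 0<S (_ , big) sp | no S≰K =
    shrink (length S ∸ 3 * ⌈ g /2⌉)
      (m+n≡o∧k≤n⇒m≤o∸k (length-below w sp) many-above)
      (m+n≡o∧k≤n⇒m≤o∸k (length-above w sp) many-below)
      (m∸n<m 0<S (ℕₚ.≤-trans (ℕₚ.⌈n/2⌉-mono {1} 0<g) (ℕₚ.m≤n*m ⌈ g /2⌉ 3)))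
      (selectCost-big {g = g} K<S 0<g (length-groups5 S) (leftover5≤4 S) cost)
    where
    g = length (groups5 S)
    K<S = ℕₚ.≰⇒> S≰K
    open GoodPivot (big K<S)
    0<g = groups5-nonempty S (ℕₚ.≤-trans (ℕₚ.m≤m+n 5 60) K<S)

  Valid : PTree n → Set
  Valid (bucket _)     = ⊤
  Valid (node l p e r) = IsPartition p (content l ++ e ++ content r) (content l , e , content r) × Valid l × Valid r

  record WellFormed (B : ℕ) (t : PTree n) : Set where
    constructor wellFormed
    field
      valid    : Valid t
      balanced : Balanced t
      buckets  : BucketsAtMost B t

  wellFormed-node : ∀ {B B′ l p e r l′ r′} → WellFormed B (node l p e r) →
                    WellFormed B′ l′ → content l′ ↭ content l → WellFormed B′ r′ → content r′ ↭ content r →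
                    WellFormed B′ (node l′ p e r′)
  wellFormed-node {l = l} {p} {e} {r} {l′} {r′} (wellFormed (sp , _) (l≤ , r≤ , 0<e , _) _)
                  (wellFormed vl′ bl′ bkl′) l′↭l (wellFormed vr′ br′ bkr′) r′↭r =
    wellFormed (split-resp w sp (↭-sym l′↭l) (↭-sym r′↭r) , vl′ , vr′)
               (resize (↭ₚ.↭-length l′↭l) l≤ , resize (↭ₚ.↭-length r′↭r) r≤ , 0<e , bl′ , br′) (bkl′ , bkr′)
    where
    resize : ∀ {a b} → a ≡ b → b ≤ ⌊ size (node l p e r) /2⌋ → a ≤ ⌊ size (node l′ p e r′) /2⌋
    resize a≡b = subst₂ (λ x s → x ≤ ⌊ s /2⌋) (sym a≡b) (sym (↭ₚ.↭-length (↭ₚ.++⁺ l′↭l (↭ₚ.++⁺ˡ e r′↭r))))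

  median-split : ∀ {S p L E R} → Selected (vals S) ⌊ length S /2⌋ (w p) → IsPartition p S (L , E , R) →
                 length L ≤ ⌊ length S /2⌋ × length R ≤ ⌊ length S /2⌋ × 0 < length E
  median-split {S} {p} {L} {E} {R} (selected _ lower upper) sp =
    L≤half ,
    ℕₚ.≤-trans (m+n≡o∧k≤n⇒m≤o∸k (length-above w sp) upper) (ℕₚ.m≤n+o⇒m∸n≤o s (suc ⌊ s /2⌋) s≤1+2half) ,
    m≤n<m+o⇒0<o L≤half (subst (⌊ s /2⌋ <_) (count≤-split w sp) upper)
    where
    s = length S
    L≤half = subst (_≤ ⌊ s /2⌋) (count<-split w sp) lower
    s≤1+2half : s ≤ suc ⌊ s /2⌋ + ⌊ s /2⌋
    s≤1+2half = ℕₚ.≤-trans (ℕₚ.≤-reflexive (sym (ℕₚ.⌊n/2⌋+⌈n/2⌉≡n s)))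
      (ℕₚ.≤-trans (ℕₚ.+-monoʳ-≤ ⌊ s /2⌋ (ℕₚ.⌊n/2⌋-mono (ℕₚ.n≤1+n (suc s)))) (ℕₚ.≤-reflexive (ℕₚ.+-comm ⌊ s /2⌋ _)))

module Algorithms (emb : Fin n → Fin m) where

  partition : Fin n → Idx n → Tree m (Part n)
  partition p []      = leaf ([] , [] , [])
  partition p (i ∷ S) = test (emb i ≶ emb p) λ s → partition p S >>= λ t → leaf (place i s t)

  -- The fallback index d is returned only when the fuel or the list runs out, which the proofs exclude.
  mutual
    momSelect : ℕ → Fin n → Idx n → ℕ → Tree m (Fin n)
    momSelect zero    d S r = leaf d
    momSelect (suc f) d S r = momPivot f d S >>= λ p → partition p S >>= λ (L , E , R) →
                           byRank (length L) (length E) r (momSelect f d L) (leaf p) (momSelect f d R)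

    momPivot : ℕ → Fin n → Idx n → Tree m (Fin n)
    momPivot f d S with length S ℕ.≤? K
    ... | yes _ = leaf (firstOr d S)
    ... | no _  = mapM (λ G → momSelect f d G 2) (groups5 S) >>= λ M → momSelect f d M ⌊ length M /2⌋

  splitBucket : Idx n → Tree m (PTree n)
  splitBucket []      = leaf (bucket [])
  splitBucket (i ∷ S) = momSelect (length (i ∷ S)) i (i ∷ S) ⌊ length (i ∷ S) /2⌋ >>= λ p →
                  partition p (i ∷ S) >>= λ (L , E , R) → leaf (node (bucket L) p E (bucket R))

  refine : PTree n → Tree m (PTree n)
  refine (bucket S)     = splitBucket S
  refine (node l p e r) = refine l >>= λ l′ → refine r >>= λ r′ → leaf (node l′ p e r′)

  countBelow : Fin m → Idx n → Tree m ℕ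
  countBelow x []      = leaf 0
  countBelow x (i ∷ S) = test (emb i ≶ x) λ s → countBelow x S >>= λ c → leaf (tally s c)

  treeRank : Fin m → PTree n → Tree m ℕ
  treeRank x (bucket S)     = countBelow x S
  treeRank x (node l p e r) = test (x ≶ emb p) λ where
    pos> → treeRank x r >>= λ c → leaf (size l + length e + c)
    _    → treeRank x l

  treeSelect : Fin n → PTree n → ℕ → Tree m (Fin n)
  treeSelect d (bucket S)      r = momSelect (length S) d S r
  treeSelect d (node l p e rr) r = byRank (size l) (length e) r (treeSelect d l) (leaf p) (treeSelect d rr)

  sumE : Idx n → Expr m
  sumE []      = con 0ℚ
  sumE (i ∷ S) = var (emb i) ⊕ sumE S

  copiesE : ℕ → Fin n → Expr m
  copiesE zero    p = con 0ℚ
  copiesE (suc k) p = var (emb p) ⊕ copiesE k p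

  -- treePrefixSum t r sums the r + 1 smallest weights of t.
  treePrefixSum : PTree n → ℕ → Tree m (Expr m)
  treePrefixSum (bucket [])      r = leaf (con 0ℚ)
  treePrefixSum (bucket (i ∷ S)) r =
    momSelect (length (i ∷ S)) i (i ∷ S) r >>= λ p → partition p (i ∷ S) >>= λ (L , E , R) →
    leaf (sumE L ⊕ copiesE (suc r ∸ length L) p)
  treePrefixSum (node l p e rr)  r = byRank (size l) (length e) r (treePrefixSum l)
    (leaf (sumE (content l) ⊕ copiesE (suc r ∸ size l) p))
    (λ r′ → treePrefixSum rr r′ >>= λ x → leaf (sumE (content l) ⊕ (sumE e ⊕ x)))

module Correctness (emb : Fin n → Fin m) (ρ : Fin m → ℚ) (w : Fin n → ℚ) (ρ∘emb : ∀ i → ρ (emb i) ≡ w i) where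
  open Algorithms emb
  open Weighted w

  partition-correct : ∀ p S → WP ρ (partition p S) (λ t c → IsPartition p S t × c ≡ length S)
  partition-correct p []      = wp-leaf (split-[] w , refl)
  partition-correct p (i ∷ S) = wp-compare (ρ∘emb i) (ρ∘emb p) λ i≶p →
    wp-seq (partition-correct p S) λ t c (sp , c≡S) →
    wp-leaf (place-correct t i≶p sp , cong suc (trans (ℕₚ.+-identityʳ c) c≡S))

  MomSelectCorrect : ℕ → Set
  MomSelectCorrect f = ∀ d S r → length S ≤ f → r < length S →
    WP ρ (momSelect f d S r) (λ q c → Selected (vals S) r (w q) × SelectCost (length S) c)

  descend-correct : ∀ {f d p S L E R r} → MomSelectCorrect f → IsPartition p S (L , E , R) →
    length L ≤ f → length R ≤ f → r < length S →
    WP ρ (byRank (length L) (length E) r (momSelect f d L) (leaf p) (momSelect f d R))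
         (λ q c → Selected (vals S) r (w q) × (∀ {b} → length L ≤ b → length R ≤ b → SelectCost b c))
  descend-correct {f} {d} {p} {S} {L} {E} {R} {r} ih sp L≤f R≤f r<S =
    byRank-elim (λ t → WP ρ t _) (length L) (length E) r
      (λ r<L → wp-mono (λ (sel , cost) → selected-left w sp sel , λ L≤b _ → selectCost-mono cost L≤b)
                       (ih d L r L≤f r<L))
      (λ L≤r r<L+E → wp-leaf (selected-pivot w sp L≤r r<L+E , λ _ _ → z≤n , λ _ → z≤n))
      (λ r′ r≡ → wp-mono (λ (sel , cost) → subst (λ k → Selected (vals S) k _) r≡ (selected-right w sp sel) ,
                                            λ _ R≤b → selectCost-mono cost R≤b)
                         (ih d R r′ R≤f (rank-right w sp r≡ r<S)))

  medians-correct : ∀ {f} d S → MomSelectCorrect f → 5 ≤ f →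
    WP ρ (mapM (λ G → momSelect f d G 2) (groups5 S))
         (λ M c → Pointwise Median5 (groups5 S) M × c ≤ length (groups5 S) * 25)
  medians-correct {f} d S ih 5≤f = wp-mapM 25 median (groups5-length S)
    where
    median : ∀ {G} → length G ≡ 5 → WP ρ (momSelect f d G 2) (λ q c → Median5 G q × c ≤ 25)
    median {G} G≡5 = wp-mono (λ (sel , _ , c≤G²) → (G≡5 , sel) , subst (λ s → _ ≤ s * s) G≡5 (c≤G² G≤K))
                             (ih d G 2 (subst (_≤ f) (sym G≡5) 5≤f) (subst (2 <_) (sym G≡5) (s≤s (s≤s (s≤s z≤n)))))
      where G≤K = subst (_≤ K) (sym G≡5) (ℕₚ.m≤m+n 5 59)

  momPivot-correct : ∀ f → MomSelectCorrect f → ∀ d S → length S ≤ suc f → 0 < length S →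
                     WP ρ (momPivot f d S) (PivotPost S)
  momPivot-correct f ih d S S≤1+f 0<S with length S ℕ.≤? K
  ... | yes S≤K = wp-leaf ((λ _ → first∈ S 0<S , refl) , λ K<S → ⊥-elim (ℕₚ.<⇒≱ K<S S≤K))
    where
    first∈ : ∀ S → 0 < length S → w (firstOr d S) ∈ vals S
    first∈ (i ∷ _) _ = here refl
  ... | no S≰K = wp-seq (medians-correct d S ih 5≤f) pivotOfMedians
    where
    g = length (groups5 S)
    K<S = ℕₚ.≰⇒> S≰K
    K≤f = ℕₚ.≤-pred (ℕₚ.≤-trans K<S S≤1+f)
    5≤f = ℕₚ.≤-trans (ℕₚ.m≤m+n 5 59) K≤f
    0<g = groups5-nonempty S (ℕₚ.≤-trans (ℕₚ.m≤m+n 5 60) K<S)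
    pivotOfMedians : ∀ M c₁ → Pointwise Median5 (groups5 S) M × c₁ ≤ g * 25 →
                     WP ρ (momSelect f d M ⌊ length M /2⌋) (λ p c₂ → PivotPost S p (c₁ + c₂))
    pivotOfMedians M c₁ (meds , c₁≤) = wp-mono (λ (sel , cost , _) → (λ S≤K → ⊥-elim (S≰K S≤K)) , λ _ → good sel cost)
      (ih d M ⌊ length M /2⌋ (subst (_≤ f) (sym M≡g) (ℕₚ.≤-pred (ℕₚ.≤-trans (groups5-fewer S 0<g) S≤1+f)))
                           (subst (λ k → ⌊ k /2⌋ < k) (sym M≡g) (0<n⇒⌊n/2⌋<n 0<g)))
      where
      M≡g : length M ≡ g
      M≡g = sym (Pointwise.Pointwise-length meds)
      good : ∀ {p c₂} → Selected (vals M) ⌊ length M /2⌋ (w p) → c₂ ≤ K * length M → GoodPivot S p (c₁ + c₂)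
      good sel c₂≤ with median-of-medians-splits meds sel
      ... | above , below = goodPivot above below (ℕₚ.+-mono-≤ c₁≤ (subst (λ k → _ ≤ K * k) M≡g c₂≤))

  momSelect-correct : ∀ f → MomSelectCorrect f
  momSelect-correct zero    d S r S≤0 r<S = ⊥-elim (ℕₚ.n≮0 (ℕₚ.<-≤-trans r<S S≤0))
  momSelect-correct (suc f) d S r S≤1+f r<S =
    wp-seq (momPivot-correct f ih d S S≤1+f 0<S) λ p c₁ pivotOK →
    wp-seq (partition-correct p S) λ where
      (L , E , R) .(length S) (sp , refl) → recurse (pivot-shrinks 0<S pivotOK sp) sp
    where
    ih = momSelect-correct f
    0<S = ℕₚ.<-≤-trans (s≤s z≤n) r<S
    recurse : ∀ {p c₁ L E R} → Shrink S L R c₁ → IsPartition p S (L , E , R) →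
              WP ρ (byRank (length L) (length E) r (momSelect f d L) (leaf p) (momSelect f d R))
                   (λ q c → Selected (vals S) r (w q) × SelectCost (length S) (c₁ + (length S + c)))
    recurse (shrink b L≤b R≤b b<S cost) sp = wp-mono (λ (sel , c) → sel , cost (c L≤b R≤b))
      (descend-correct ih sp (ℕₚ.≤-trans L≤b b≤f) (ℕₚ.≤-trans R≤b b≤f) r<S)
      where b≤f = ℕₚ.≤-pred (ℕₚ.≤-trans b<S S≤1+f)

  splitBucket-correct : ∀ S → WP ρ (splitBucket S)
    (λ t c → WellFormed ⌊ length S /2⌋ t × content t ↭ S × c ≤ suc K * length S)
  splitBucket-correct []        = wp-leaf (wellFormed tt tt z≤n , ↭-refl , z≤n)
  splitBucket-correct S@(i ∷ _) =
    wp-seq (momSelect-correct (length S) i S ⌊ length S /2⌋ ℕₚ.≤-refl (0<n⇒⌊n/2⌋<n (s≤s z≤n)))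
      λ p c₁ (sel , c₁≤ , _) →
    wp-seq (partition-correct p S) λ where
      (L , E , R) .(length S) (sp , refl) → wp-leaf (built sel sp c₁≤)
    where
    built : ∀ {p L E R c₁} → Selected (vals S) ⌊ length S /2⌋ (w p) → IsPartition p S (L , E , R) →
            c₁ ≤ K * length S → WellFormed ⌊ length S /2⌋ (node (bucket L) p E (bucket R)) ×
                                L ++ E ++ R ↭ S × c₁ + (length S + 0) ≤ suc K * length S
    built {p} {L} {E} {R} sel sp c₁≤ with median-split sel sp
    ... | L≤ , R≤ , 0<E =
      wellFormed (split-resp w sp ↭-refl ↭-refl , tt , tt)
                 (subst (λ s → length L ≤ ⌊ s /2⌋) S≡ L≤ , subst (λ s → length R ≤ ⌊ s /2⌋) S≡ R≤ , 0<E , tt , tt)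
                 (L≤ , R≤) ,
      ↭-sym (Split.perm sp) ,
      ℕₚ.≤-trans (ℕₚ.+-mono-≤ c₁≤ (ℕₚ.≤-reflexive (ℕₚ.+-identityʳ _))) (ℕₚ.≤-reflexive (ℕₚ.+-comm (K * length S) _))
      where S≡ = ↭ₚ.↭-length (Split.perm sp)

  refine-correct : ∀ t {B} → WellFormed B t →
    WP ρ (refine t) (λ t′ c → WellFormed ⌊ B /2⌋ t′ × content t′ ↭ content t × c ≤ suc K * size t)
  refine-correct (bucket S) (wellFormed _ _ S≤B) =
    wp-mono (λ (wellFormed v b bk , perm , c≤) →
               wellFormed v b (BucketsAtMost-mono _ (ℕₚ.⌊n/2⌋-mono S≤B) bk) , perm , c≤)
            (splitBucket-correct S)
  refine-correct (node l p e r) wf@(wellFormed (_ , vl , vr) (_ , _ , _ , bl , br) (bkl , bkr)) =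
    wp-seq (refine-correct l (wellFormed vl bl bkl)) λ l′ c₁ (wfl , l′↭l , c₁≤) →
    wp-seq (refine-correct r (wellFormed vr br bkr)) λ r′ c₂ (wfr , r′↭r , c₂≤) →
    wp-leaf (wellFormed-node wf wfl l′↭l wfr r′↭r , ↭ₚ.++⁺ l′↭l (↭ₚ.++⁺ˡ e r′↭r) , cost c₁≤ c₂≤)
    where
    open ℕₚ.≤-Reasoning
    cost : ∀ {c₁ c₂} → c₁ ≤ suc K * size l → c₂ ≤ suc K * size r → c₁ + (c₂ + 0) ≤ suc K * size (node l p e r)
    cost {c₁} {c₂} c₁≤ c₂≤ = begin
      c₁ + (c₂ + 0)                      ≤⟨ ℕₚ.+-mono-≤ c₁≤ (m≤n⇒m+0≤n c₂≤) ⟩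
      suc K * size l + suc K * size r    ≡⟨ ℕₚ.*-distribˡ-+ (suc K) (size l) (size r) ⟨
      suc K * (size l + size r)          ≤⟨ ℕₚ.*-monoʳ-≤ (suc K)
                                              (ℕₚ.+-monoʳ-≤ (size l) (ℕₚ.m≤n+m (size r) (length e))) ⟩
      suc K * (size l + (length e + size r))  ≡⟨ cong (suc K *_) (size-node l p e r) ⟨
      suc K * size (node l p e r)        ∎

  module _ {x a} (ρx≡a : ρ x ≡ a) where

    countBelow-correct : ∀ S → WP ρ (countBelow x S) (λ k c → k ≡ count< a (vals S) × c ≡ length S)
    countBelow-correct []      = wp-leaf (refl , refl)
    countBelow-correct (i ∷ S) = wp-compare (ρ∘emb i) ρx≡a λ i≶x →
      wp-seq (countBelow-correct S) λ k c (k≡ , c≡S) →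
      wp-leaf (trans (cong (tally _) k≡) (sym (count<-∷ (vals S) i≶x)) , cong suc (trans (ℕₚ.+-identityʳ c) c≡S))

    treeRank-correct : ∀ t {B} → Valid t → BucketsAtMost B t →
      WP ρ (treeRank x t) (λ k c → k ≡ count< a (vals (content t)) × c ≤ depth t + B)
    treeRank-correct (bucket S) _ S≤B = wp-mono (λ (k≡ , c≡S) → k≡ , ℕₚ.≤-trans (ℕₚ.≤-reflexive c≡S) S≤B)
                                                (countBelow-correct S)
    treeRank-correct (node l p e r) {B} (sp , vl , vr) (bl , br) = wp-compare ρx≡a (ρ∘emb p) λ where
        (less a<p)    → go-left (ℚₚ.<⇒≤ a<p)
        (equal a≡p)   → go-left (ℚₚ.≤-reflexive a≡p)
        (greater p<a) → wp-seq (treeRank-correct r vr br) λ k c (k≡ , c≤) →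
          wp-leaf (trans (cong (size l + length e +_) k≡) (sym (count<-right w sp p<a)) ,
                   s≤s (m≤n⇒m+0≤n (ℕₚ.≤-trans c≤ (ℕₚ.+-monoˡ-≤ B (ℕₚ.m≤n⊔m (depth l) _)))))
      where
      go-left : a ℚ.≤ w p → WP ρ (treeRank x l)
                  (λ k c → k ≡ count< a (vals (content (node l p e r))) × suc c ≤ depth (node l p e r) + B)
      go-left a≤p = wp-mono (λ (k≡ , c≤) → trans k≡ (sym (count<-left w sp a≤p)) ,
                                           s≤s (ℕₚ.≤-trans c≤ (ℕₚ.+-monoˡ-≤ B (ℕₚ.m≤m⊔n _ (depth r)))))
                            (treeRank-correct l vl bl)

  treeSelect-correct : ∀ d t {B} r → Valid t → BucketsAtMost B t → r < size t →
    WP ρ (treeSelect d t r) (λ q c → Selected (vals (content t)) r (w q) × c ≤ K * B)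
  treeSelect-correct d (bucket S) r _ S≤B r<S =
    wp-mono (λ (sel , c≤ , _) → sel , ℕₚ.≤-trans c≤ (ℕₚ.*-monoʳ-≤ K S≤B))
            (momSelect-correct (length S) d S r ℕₚ.≤-refl r<S)
  treeSelect-correct d (node l p e rr) r (sp , vl , vr) (bl , br) r<t =
    byRank-elim (λ u → WP ρ u _) (size l) (length e) r
      (λ r<l → wp-mono (λ (sel , c≤) → selected-left w sp sel , c≤) (treeSelect-correct d l r vl bl r<l))
      (λ l≤r r<l+e → wp-leaf (selected-pivot w sp l≤r r<l+e , z≤n))
      (λ r′ r≡ → wp-mono (λ (sel , c≤) → subst (λ k → Selected _ k _) r≡ (selected-right w sp sel) , c≤)
                         (treeSelect-correct d rr r′ vr br (rank-right w sp r≡ r<t)))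

  eval-sumE : ∀ S → eval ρ (sumE S) ≡ sumℚ (vals S)
  eval-sumE []      = refl
  eval-sumE (i ∷ S) = cong₂ ℚ._+_ (ρ∘emb i) (eval-sumE S)

  eval-copiesE : ∀ k p → eval ρ (copiesE k p) ≡ sumℚ (replicate k (w p))
  eval-copiesE zero    p = refl
  eval-copiesE (suc k) p = cong₂ ℚ._+_ (ρ∘emb p) (eval-copiesE k p)

  treePrefixSum-correct : ∀ t {B} r → Valid t → BucketsAtMost B t → r < size t →
    WP ρ (treePrefixSum t r) (λ x c → PrefixSum (vals (content t)) (suc r) (eval ρ x) × c ≤ suc K * B)
  treePrefixSum-correct (bucket S@(i ∷ _)) {B} r _ S≤B r<S =
    wp-seq (momSelect-correct (length S) i S r ℕₚ.≤-refl r<S) λ p c₁ (sel , c₁≤ , _) →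
    wp-seq (partition-correct p S) λ where
      (L , E , R) .(length S) (sp , refl) → wp-leaf (sum sel sp , cost c₁≤)
    where
    sum : ∀ {p L E R} → Selected (vals S) r (w p) → IsPartition p S (L , E , R) →
          PrefixSum (vals S) (suc r) (eval ρ (sumE L ⊕ copiesE (suc r ∸ length L) p))
    sum {p} {L} (selected _ lower upper) sp =
      subst (PrefixSum (vals S) (suc r)) (sym (cong₂ ℚ._+_ (eval-sumE L) (eval-copiesE (suc r ∸ length L) p)))
        (prefixSum-pivot w sp (s≤s (subst (_≤ r) (count<-split w sp) lower)) (subst (r <_) (count≤-split w sp) upper))
    cost : ∀ {c₁} → c₁ ≤ K * length S → c₁ + (length S + 0) ≤ suc K * B
    cost c₁≤ = ℕₚ.≤-trans (ℕₚ.+-mono-≤ c₁≤ (ℕₚ.≤-reflexive (ℕₚ.+-identityʳ _)))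
                 (ℕₚ.≤-trans (ℕₚ.≤-reflexive (ℕₚ.+-comm (K * length S) _)) (ℕₚ.*-monoʳ-≤ (suc K) S≤B))
  treePrefixSum-correct (node l p e rr) r (sp , vl , vr) (bl , br) r<t =
    byRank-elim (λ u → WP ρ u _) (size l) (length e) r
      (λ r<l → wp-mono (λ (ps , c≤) → prefixSum-left w sp ps , c≤) (treePrefixSum-correct l r vl bl r<l))
      (λ l≤r r<l+e → wp-leaf (subst (PrefixSum _ (suc r))
                               (sym (cong₂ ℚ._+_ (eval-sumE (content l)) (eval-copiesE (suc r ∸ size l) p)))
                               (prefixSum-pivot w sp (s≤s l≤r) r<l+e) , z≤n))
      (λ r′ r≡ → wp-seq (treePrefixSum-correct rr r′ vr br (rank-right w sp r≡ r<t)) λ x c (ps , c≤) →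
                 wp-leaf (subst₂ (PrefixSum _) (trans (ℕₚ.+-suc _ r′) (cong suc r≡))
                            (sym (cong₂ ℚ._+_ (eval-sumE (content l)) (cong (ℚ._+ eval ρ x) (eval-sumE e))))
                            (prefixSum-right w sp ps) ,
                          m≤n⇒m+0≤n c≤))

-- The deferred structure

budget-keep : ∀ {acc} a B d k P → acc ≤ a + suc K * (B * d) + k * P →
              acc + 0 + (P + suc K * B) ≤ a + suc K * (B * suc d) + suc k * P
budget-keep {acc} a B d k P acc≤ =
  ℕₚ.≤-trans (ℕₚ.+-monoˡ-≤ (P + suc K * B) (ℕₚ.+-monoˡ-≤ 0 acc≤)) (ℕₚ.≤-reflexive (regroup a B d k P))
  where
  regroup : ∀ a B d k P → a + suc K * (B * d) + k * P + 0 + (P + suc K * B) ≡ a + suc K * (B * suc d) + suc k * P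
  regroup = solve-∀

budget-refine : ∀ {acc c} j N B d k P B′ → acc ≤ 2 * suc K * N * j + suc K * (B * d) + k * P →
                B * d ≤ N → c ≤ suc K * N →
                acc + c + (P + suc K * B′) ≤ 2 * suc K * N * suc j + suc K * (B′ * 1) + suc k * P
budget-refine {acc} {c} j N B d k P B′ acc≤ Bd≤N c≤ = begin
  acc + c + (P + suc K * B′)                                          ≤⟨ ℕₚ.+-monoˡ-≤ _ (ℕₚ.+-mono-≤ acc≤ c≤) ⟩
  2 * suc K * N * j + suc K * (B * d) + k * P + suc K * N + (P + suc K * B′)
    ≤⟨ ℕₚ.+-monoˡ-≤ (P + suc K * B′) (ℕₚ.+-monoˡ-≤ (suc K * N)
         (ℕₚ.+-monoˡ-≤ (k * P) (ℕₚ.+-monoʳ-≤ (2 * suc K * N * j) (ℕₚ.*-monoʳ-≤ (suc K) Bd≤N)))) ⟩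
  2 * suc K * N * j + suc K * N + k * P + suc K * N + (P + suc K * B′) ≡⟨ regroup j N k P B′ ⟩
  2 * suc K * N * suc j + suc K * (B′ * 1) + suc k * P                ∎
  where
  open ℕₚ.≤-Reasoning
  regroup : ∀ j N k P B′ → 2 * suc K * N * j + suc K * N + k * P + suc K * N + (P + suc K * B′) ≡
                           2 * suc K * N * suc j + suc K * (B′ * 1) + suc k * P
  regroup = solve-∀

budget-final : ∀ {j L} N B d q P → j ≤ L → B * d ≤ N →
               2 * suc K * N * j + suc K * (B * d) + q * P ≤ 2 * suc K * (N * (1 + L) + q * P)
budget-final {j} {L} N B d q P j≤L Bd≤N = begin
  2 * suc K * N * j + suc K * (B * d) + q * P
    ≤⟨ ℕₚ.+-monoˡ-≤ (q * P) (ℕₚ.+-mono-≤ (ℕₚ.*-monoʳ-≤ (2 * suc K * N) j≤L) (ℕₚ.*-monoʳ-≤ (suc K) Bd≤N)) ⟩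
  2 * suc K * N * L + suc K * N + q * P
    ≤⟨ ℕₚ.+-mono-≤ (ℕₚ.+-monoʳ-≤ (2 * suc K * N * L) (ℕₚ.*-monoˡ-≤ N (ℕₚ.m≤n*m (suc K) 2)))
                   (ℕₚ.m≤n*m (q * P) (2 * suc K)) ⟩
  2 * suc K * N * L + 2 * suc K * N + 2 * suc K * (q * P)   ≡⟨ regroup N L q P ⟩
  2 * suc K * (N * (1 + L) + q * P)                         ∎
  where
  open ℕₚ.≤-Reasoning
  regroup : ∀ N L q P → 2 * suc K * N * L + 2 * suc K * N + 2 * suc K * (q * P) ≡ 2 * suc K * (N * (1 + L) + q * P)
  regroup = solve-∀

record Config (n : ℕ) : Set where
  constructor config
  field
    phase       : ℕ
    bucketBound : ℕ
    tree        : PTree n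
open Config

allIdx : ∀ n → Idx n
allIdx n = Vec.toList (Vec.allFin n)

module Structure (n : ℕ) where

  weightVar : ∀ k → Fin n → Fin (n + suc k)
  weightVar k i = i Fin.↑ˡ suc k

  argumentVar : ∀ k → Fin (n + suc k)
  argumentVar k = n Fin.↑ʳ Fin.fromℕ k

  module _ (k : ℕ) where
    open Algorithms (weightVar k)

    prepare : Config n → Tree (n + suc k) (Config n)
    prepare (config j B t) with 2 ^ suc j ℕ.≤? suc k
    ... | yes _ = refine t >>= λ t′ → leaf (config (suc j) ⌊ B /2⌋ t′)
    ... | no _  = leaf (config j B t)

    respond : PTree n → Query n → Tree (n + suc k) (Expr (n + suc k))
    respond t rank                   = treeRank (argumentVar k) t >>= λ c → leaf (con (fromℕ c))
    respond t (select i)             = treeSelect i t (Fin.toℕ i) >>= λ q → leaf (var (weightVar k q))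
    respond t (partialSum Fin.zero)    = leaf (con 0ℚ)
    respond t (partialSum (Fin.suc r)) = treePrefixSum t (Fin.toℕ r)

    answerQuery : Config n → Query n → Tree (n + suc k) (Expr (n + suc k) × Config n)
    answerQuery c q = prepare c >>= λ c′ → respond (tree c′) q >>= λ e → leaf (e , c′)

  deferred : DS n
  deferred = record { State = Config n ; init = config 0 n (bucket (allIdx n)) ; step = answerQuery }

  module Analysis (W : Vec ℚ n) where
    w : Fin n → ℚ
    w = Vec.lookup W
    open Weighted w

    depthBound : ℕ
    depthBound = suc ⌊log₂ n ⌋

    record Invariant (k : ℕ) (c : Config n) : Set where
      constructor invariant
      field
        shape     : WellFormed (bucketBound c) (tree c)
        complete  : content (tree c) ↭ allIdx n
        balance   : bucketBound c * 2 ^ phase c ≤ n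
        started   : 2 ^ phase c ≤ suc k
        pending   : suc k ≤ 2 ^ suc (phase c)
        phase≤log : phase c ≤ ⌊log₂ k ⌋
    open Invariant

    initial : Invariant 0 (config 0 n (bucket (allIdx n)))
    initial = invariant (wellFormed tt tt (ℕₚ.≤-reflexive (Vecₚ.length-toList (Vec.allFin n)))) ↭-refl
                        (ℕₚ.≤-reflexive (ℕₚ.*-identityʳ n)) ℕₚ.≤-refl (s≤s z≤n) z≤n

    continue-step : ∀ {k c} → Invariant k c → suc k < 2 ^ suc (phase c) → Invariant (suc k) c
    continue-step {k} inv 1+k<2^[1+j] =
      invariant (shape inv) (complete inv) (balance inv) (ℕₚ.m≤n⇒m≤1+n (started inv))
                1+k<2^[1+j] (ℕₚ.≤-trans (phase≤log inv) (⌊log₂⌋-mono-≤ (ℕₚ.n≤1+n k)))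

    refine-step : ∀ {k j B t t′} → Invariant k (config j B t) → 2 ^ suc j ≡ suc k →
                  WellFormed ⌊ B /2⌋ t′ → content t′ ↭ content t → Invariant (suc k) (config (suc j) ⌊ B /2⌋ t′)
    refine-step {k} {j} {B} inv 2^[1+j]≡1+k shape′ t′↭t = invariant shape′ (↭-trans t′↭t (complete inv))
      (ℕₚ.≤-trans (ℕₚ.≤-reflexive (reassoc ⌊ B /2⌋ (2 ^ j)))
                  (ℕₚ.≤-trans (ℕₚ.*-monoˡ-≤ (2 ^ j) (2*⌊n/2⌋≤n B)) (balance inv)))
      (ℕₚ.≤-trans (ℕₚ.≤-reflexive 2^[1+j]≡1+k) (ℕₚ.n≤1+n _))
      (subst (λ x → suc (suc k) ≤ 2 * x) (sym 2^[1+j]≡1+k)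
             (ℕₚ.≤-trans (ℕₚ.m≤m+n (suc (suc k)) k) (ℕₚ.≤-reflexive (double k))))
      (ℕₚ.≤-reflexive (sym (trans (cong ⌊log₂_⌋ (sym 2^[1+j]≡1+k)) (⌊log₂[2^n]⌋≡n (suc j)))))
      where
      reassoc : ∀ a b → a * (2 * b) ≡ 2 * a * b
      reassoc = solve-∀
      double : ∀ k → suc (suc k) + k ≡ 2 * suc k
      double = solve-∀

    -- Every refinement adds 2·65·n: 65·n pays for the refinement itself and 65·n for the bucket searches
    -- (65·B each) of the at most 2^j queries of the phase it ends, as B·2^j ≤ n. The middle term is what
    -- the bucket searches of the current phase have used so far.
    potential : ℕ → Config n → ℕ
    potential k c = 2 * suc K * n * phase c + suc K * (bucketBound c * (suc k ∸ 2 ^ phase c)) + k * depthBound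

    phase-work : ∀ {k c} → Invariant k c → bucketBound c * (suc k ∸ 2 ^ phase c) ≤ n
    phase-work {k} {c} inv = ℕₚ.≤-trans (ℕₚ.*-monoʳ-≤ (bucketBound c) (ℕₚ.m≤n+o⇒m∸n≤o (suc k) (2 ^ phase c)
      (ℕₚ.≤-trans (pending inv) (ℕₚ.≤-reflexive (cong (2 ^ phase c +_) (ℕₚ.+-identityʳ _)))))) (balance inv)

    continue-budget : ∀ {k c acc} → Invariant k c → acc ≤ potential k c →
                      acc + 0 + (depthBound + suc K * bucketBound c) ≤ potential (suc k) c
    continue-budget {k} {config j B _} {acc} inv acc≤ =
      subst (λ d → acc + 0 + (depthBound + suc K * B) ≤ 2 * suc K * n * j + suc K * (B * d) + suc k * depthBound)
            (sym (ℕₚ.+-∸-assoc 1 (started inv)))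
            (budget-keep (2 * suc K * n * j) B (suc k ∸ 2 ^ j) k depthBound acc≤)

    refine-budget : ∀ {k j B t t′ acc c} → Invariant k (config j B t) → 2 ^ suc j ≡ suc k →
                    acc ≤ potential k (config j B t) → c ≤ suc K * n →
                    acc + c + (depthBound + suc K * ⌊ B /2⌋) ≤ potential (suc k) (config (suc j) ⌊ B /2⌋ t′)
    refine-budget {k} {j} {B} {acc = acc} {c} inv 2^[1+j]≡1+k acc≤ c≤ =
      subst (λ d → acc + c + (depthBound + suc K * ⌊ B /2⌋) ≤
                   2 * suc K * n * suc j + suc K * (⌊ B /2⌋ * d) + suc k * depthBound)
            (sym (trans (cong (suc (suc k) ∸_) 2^[1+j]≡1+k) (ℕₚ.m+n∸n≡m 1 (suc k))))
            (budget-refine j n B (suc k ∸ 2 ^ j) k depthBound ⌊ B /2⌋ acc≤ (phase-work inv) c≤)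

    values-complete : ∀ {S} → S ↭ allIdx n → map w S ↭ Vec.toList W
    values-complete S↭all = ↭-trans (↭ₚ.map⁺ w S↭all)
      (↭-reflexive (trans (sym (Vecₚ.toList-map w (Vec.allFin n))) (cong Vec.toList (Vecₚ.map-lookup-allFin W))))

    size-complete : ∀ t → content t ↭ allIdx n → size t ≡ n
    size-complete t t↭all = trans (↭ₚ.↭-length t↭all) (Vecₚ.length-toList (Vec.allFin n))

    values-sorted : ∀ {S} → S ↭ allIdx n → map w S ↭ sort (Vec.toList W)
    values-sorted S↭all = ↭-trans (values-complete S↭all) (↭-sym (sort-↭ (Vec.toList W)))

    sorted-W : Sorted (sort (Vec.toList W))
    sorted-W = Linkedₚ.Linked⇒AllPairs ℚₚ.≤-trans (sort-↗ (Vec.toList W))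

    module AtQuery {k} (xs : Vec ℚ k) (x : ℚ) where
      ρ : Fin (n + suc k) → ℚ
      ρ = Vec.lookup (W Vec.++ (xs Vec.∷ʳ x))

      ρ∘weightVar : ∀ i → ρ (weightVar k i) ≡ w i
      ρ∘weightVar i = Vecₚ.lookup-++ˡ W (xs Vec.∷ʳ x) i

      ρ-argument : ρ (argumentVar k) ≡ x
      ρ-argument = trans (Vecₚ.lookup-++ʳ W (xs Vec.∷ʳ x) (Fin.fromℕ k)) (lookup-∷ʳ-fromℕ xs x)

      open Correctness (weightVar k) ρ w ρ∘weightVar

      respond-correct : ∀ {t B} q → WellFormed B t → content t ↭ allIdx n →
        WP ρ (respond k t q) (λ e c → eval ρ e ≡ answer W (q , x) × c ≤ depthBound + suc K * B)
      respond-correct {t} {B} rank (wellFormed v bal bk) t↭all =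
        wp-seq (treeRank-correct ρ-argument t v bk) λ r c (r≡ , c≤) →
        wp-leaf (cong fromℕ (trans r≡ (count-↭ (ℚₚ._<? x) (values-complete t↭all))) ,
                 m≤n⇒m+0≤n (ℕₚ.≤-trans c≤ (ℕₚ.+-mono-≤ depth≤ (ℕₚ.m≤n*m B (suc K)))))
        where
        depth≤ : depth t ≤ depthBound
        depth≤ = depth-balanced t depthBound bal
                   (subst (_< 2 ^ depthBound) (sym (size-complete t t↭all)) (n<2^[1+⌊log₂n⌋] n))
      respond-correct {t} {B} (select i) (wellFormed v _ bk) t↭all =
        wp-seq (treeSelect-correct i t (Fin.toℕ i) v bk i<t) λ q c (sel , c≤) →
        wp-leaf (trans (ρ∘weightVar q) (sym (nth-sorted-↭ sorted-W (values-sorted t↭all) sel)) ,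
                 m≤n⇒m+0≤n (ℕₚ.≤-trans c≤ (ℕₚ.≤-trans (ℕₚ.*-monoˡ-≤ B (ℕₚ.n≤1+n K)) (ℕₚ.m≤n+m _ depthBound))))
        where i<t = subst (Fin.toℕ i <_) (sym (size-complete t t↭all)) (Finₚ.toℕ<n i)
      respond-correct (partialSum Fin.zero) _ _ = wp-leaf (refl , z≤n)
      respond-correct {t} {B} (partialSum (Fin.suc r)) (wellFormed v _ bk) t↭all =
        wp-mono (λ (ps , c≤) → sum-take-sorted-↭ sorted-W (values-sorted t↭all) ps ,
                               ℕₚ.≤-trans c≤ (ℕₚ.m≤n+m _ depthBound))
                (treePrefixSum-correct t (Fin.toℕ r) v bk r<t)
        where r<t = subst (Fin.toℕ r <_) (sym (size-complete t t↭all)) (Finₚ.toℕ<n r)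

      prepare-correct : ∀ {c acc} → Invariant k c → acc ≤ potential k c →
        WP ρ (prepare k c)
           (λ c′ cost → Invariant (suc k) c′ ×
                        acc + cost + (depthBound + suc K * bucketBound c′) ≤ potential (suc k) c′)
      prepare-correct {config j B t} inv acc≤ with 2 ^ suc j ℕ.≤? suc k
      ... | yes due = wp-seq (refine-correct t (shape inv)) λ t′ c (shape′ , t′↭t , c≤) →
        wp-leaf (refine-step inv full shape′ t′↭t ,
                 refine-budget {t′ = t′} inv full acc≤
                   (m≤n⇒m+0≤n (subst (λ s → c ≤ suc K * s) (size-complete t (complete inv)) c≤)))
        where full = ℕₚ.≤-antisym due (pending inv)
      ... | no notDue = wp-leaf (continue-step inv (ℕₚ.≰⇒> notDue) , continue-budget inv acc≤)

      step-correct : ∀ {c acc} q → Invariant k c → acc ≤ potential k c →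
        WP ρ (answerQuery k c q)
           (λ (e , c′) cost → eval ρ e ≡ answer W (q , x) × Invariant (suc k) c′ × acc + cost ≤ potential (suc k) c′)
      step-correct {acc = acc} q inv acc≤ =
        wp-seq (prepare-correct inv acc≤) λ c′ cost₁ (inv′ , within) →
        wp-seq (respond-correct q (shape inv′) (complete inv′)) λ e cost₂ (e≡ , cost₂≤) →
        wp-leaf (e≡ , inv′ , ℕₚ.≤-trans (ℕₚ.≤-reflexive (sym (ℕₚ.+-assoc acc cost₁ _)))
                               (ℕₚ.≤-trans (ℕₚ.+-monoʳ-≤ (acc + cost₁) (m≤n⇒m+0≤n cost₂≤)) within))

    budget : ℕ → ℕ
    budget q = 2 * suc K * (n * (1 + ⌊log₂ q ⌋) + q * depthBound)

    run-correct : ∀ qs {k} (xs : Vec ℚ k) c acc → Invariant k c → acc ≤ potential k c →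
      proj₁ (runFrom deferred c W xs qs) ≡ map (answer W) qs ×
      acc + proj₂ (runFrom deferred c W xs qs) ≤ budget (k + length qs)
    run-correct [] {k} xs c acc inv acc≤ =
      refl , m≤n⇒m+0≤n (ℕₚ.≤-trans acc≤ (subst (λ q → potential k c ≤ budget q) (sym (ℕₚ.+-identityʳ k))
               (budget-final {L = ⌊log₂ k ⌋} n (bucketBound c) _ k depthBound (phase≤log inv) (phase-work inv))))
    run-correct ((q , x) ∷ rest) {k} xs c acc inv acc≤ =
      cong₂ _∷_ (proj₁ now) (proj₁ later) ,
      ℕₚ.≤-trans (ℕₚ.≤-reflexive (sym (ℕₚ.+-assoc acc cost _)))
        (subst (λ m → acc + cost + proj₂ (runFrom deferred (proj₂ (proj₁ outcome)) W (xs Vec.∷ʳ x) rest) ≤ budget m)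
               (sym (ℕₚ.+-suc k (length rest))) (proj₂ later))
      where
      open AtQuery xs x
      outcome = runTree ρ (answerQuery k c q)
      cost = proj₂ outcome
      now = unwp (step-correct q inv acc≤)
      later = run-correct rest (xs Vec.∷ʳ x) (proj₂ (proj₁ outcome)) (acc + cost)
                          (proj₁ (proj₂ now)) (proj₂ (proj₂ now))

    deferred-correct : ∀ qs → proj₁ (run deferred W qs) ≡ map (answer W) qs ×
                              proj₂ (run deferred W qs) ≤ budget (length qs)
    deferred-correct qs = run-correct qs Vec.[] _ 0 initial z≤n

mainTheorem3 : Σ ℕ λ c → (n : ℕ) → Σ (DS n) λ d →
    (W : Vec ℚ n) → All Positive W → (qs : List (Query n × ℚ)) →
    proj₁ (run d W qs) ≡ map (answer W) qs
    × proj₂ (run d W qs)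
        ≤ c * (n * (1 + ⌊log₂ length qs ⌋) + length qs * (1 + ⌊log₂ n ⌋))
mainTheorem3 = 2 * suc K , λ n → Structure.deferred n , λ W _ → Structure.Analysis.deferred-correct n W
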